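{- If $M[x^L:=N]:\langle\Gamma\vdash U\rangle$ and $x^L\in\mathrm{fv}(M)$, then there exist a type $V$ and type environments $\Gamma_1,\Gamma_2$ such that $M:\langle\Gamma_1,x^L:V\vdash U\rangle$, $N:\langle\Gamma_2\vdash V\rangle$ and $\Gamma=\Gamma_1\sqcap\Gamma_2$.
   Context: Indexes: finite sequences of natural numbers ($\mathcal L_{\mathbb N}$), $\oslash$ empty, $i::L$ prepending $i$, $L_1\preceq L_2$ (also $L_2\succeq L_1$) iff $L_2=L_1::L_3$ for some $L_3$ (concatenation). Terms: over a countably infinite set $\mathcal V$, terms $\mathcal M$, free indexed variables $\mathrm{fv}$, degree $d$, joinability $\diamond$ defined simultaneously: $x^L\in\mathcal M$ ($\mathrm{fv}=\{x^L\}$, $d=L$); $MN\in\mathcal M$ when $d(M)\preceq d(N)$, $M\diamond N$ ($\mathrm{fv}$ union, $d(MN)=d(M)$); $\lambda x^L.M\in\mathcal M$ when $L\succeq d(M)$ ($\mathrm{fv}(M)\setminus\{x^L\}$, $d=d(M)$). $M\diamond N$ iff $x^L\in\mathrm{fv}(M)$, $x^K\in\mathrm{fv}(N)$ imply $L=K$. Terms modulo $\alpha$; capture-avoiding substitution $M[x^L:=N]$ defined only if $M\diamond N$ and $d(N)=L$. Lifting $(x^L)^{+i}=x^{i::L}$, $(M_1M_2)^{+i}=M_1^{+i}M_2^{+i}$, $(\lambda x^L.M)^{+i}=\lambda x^{i::L}.M^{+i}$. Types: atomic types $\mathcal A$, expansion variables $\overline e_0,\overline e_1,\dots$; $\mathbb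 T\subseteq\mathbb U$ with degree: $a\in\mathbb T$ ($d=\oslash$); $U\to T\in\mathbb T$ for $U\in\mathbb U,T\in\mathbb T$ ($d=\oslash$); $\omega^L\in\mathbb U$ ($d=L$); $U_1\sqcap U_2$ if $d(U_1)=d(U_2)$; $\overline e_iU$ ($d=i::d(U)$); modulo $\sqcap$ commutative, associative, idempotent, $\overline e_i(U_1\sqcap U_2)=\overline e_iU_1\sqcap\overline e_iU_2$, $\omega^L\sqcap U=U$ ($d(U)=L$), $\overline e_i\omega^K=\omega^{i::K}$. Environments: finite sets of declarations $x^L:U$ (at most one per $x^L$); $\Gamma,\Delta$ disjoint union; $env^\omega_M$ assigns $\omega^L$ to each $x^L\in\mathrm{fv}(M)$; $\Gamma_1\sqcap\Gamma_2$ intersects types of common variables (of equal degree), keeps others; $\overline e_j\Gamma$ replaces $x^L:U$ by $x^{j::L}:\overline e_jU$; $\Gamma_1\diamond\Gamma_2$ iff $x^L\in\mathrm{dom}\,\Gamma_1$, $x^K\in\mathrm{dom}\,\Gamma_2$ imply $L=K$. Subtyping $\sqsubseteq$: least relation on types, environments and typings closed under reflexivity, transitivity, $U_1\sqcap U_2\sqsubseteq U_1$ ($d(U_1)=d(U_2)$), $U_1\sqcap U_2\sqsubseteq V_1\sqcap V_2$ if $U_i\sqsubseteq V_i$, $U_1\to T_1\sqsubseteq U_2\to T_2$ if $U_2\sqsubseteq U_1$, $T_1\sqsubseteq T_2$, $\overline e_iU_1\sqsubseteq\overline e_iU_2$ if $U_1\sqsubseteq U_2$, $\Gamma,y^L:U_1\sqsubseteq\Gamma,y^L:U_2$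 if $U_1\sqsubseteq U_2$, $\langle\Gamma_1\vdash U_1\rangle\sqsubseteq\langle\Gamma_2\vdash U_2\rangle$ if $U_1\sqsubseteq U_2$, $\Gamma_2\sqsubseteq\Gamma_1$. Typing rules ($T\in\mathbb T$): (ax) $x^\oslash:\langle(x^\oslash:T)\vdash T\rangle$; ($\omega$) $M:\langle env^\omega_M\vdash\omega^{d(M)}\rangle$; ($\to_I$) $M:\langle\Gamma,(x^L:U)\vdash T\rangle\Rightarrow\lambda x^L.M:\langle\Gamma\vdash U\to T\rangle$; ($\to'_I$) $M:\langle\Gamma\vdash T\rangle$, $x^L\notin\mathrm{dom}\,\Gamma\Rightarrow\lambda x^L.M:\langle\Gamma\vdash\omega^L\to T\rangle$; ($\to_E$) $M_1:\langle\Gamma_1\vdash U\to T\rangle$, $M_2:\langle\Gamma_2\vdash U\rangle$, $\Gamma_1\diamond\Gamma_2\Rightarrow M_1M_2:\langle\Gamma_1\sqcap\Gamma_2\vdash T\rangle$; ($\sqcap_I$) $M:\langle\Gamma\vdash U_1\rangle$, $M:\langle\Gamma\vdash U_2\rangle\Rightarrow M:\langle\Gamma\vdash U_1\sqcap U_2\rangle$; ($e$) $M:\langle\Gamma\vdash U\rangle\Rightarrow M^{+j}:\langle\overline e_j\Gamma\vdash\overline e_jU\rangle$; ($\sqsubseteq$) $M:\langle\Gamma\vdash U\rangle$, $\langle\Gamma\vdash U\rangle\sqsubseteq\langle\Gamma'\vdash U'\rangle\Rightarrow M:\langle\Gamma'\vdash U'\rangle$. -}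

module Defs where

open import Data.Nat using (ℕ; zero; suc; _⊔_)
import Data.Bool
open import Data.Bool using (Bool; true; false; if_then_else_)
open import Data.List using (List; []; _∷_; _++_; map; filter; foldr; concatMap; deduplicate)
open import Data.List.Membership.Propositional using (_∈_; _∉_)
open import Data.List.Relation.Unary.All using (All)
open import Data.List.Relation.Unary.Unique.Propositional using (Unique)
open import Data.List.Relation.Binary.Permutation.Propositional using (_↭_)
open import Data.List.Relation.Binary.Pointwise using (Pointwise)
open import Data.Maybe using (Maybe; just; nothing)
open import Data.Product using (Σ; ∃; _×_; _,_; proj₁; proj₂)
open import Data.Product.Properties using (≡-dec)
import Data.Nat.Properties as ℕP
import Data.List.Properties as LP
open import Relation.Binary.PropositionalEquality using (_≡_)
open import Relation.Binary.Definitions using (DecidableEquality)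
open import Relation.Nullary using (yes; no; ¬_)
open import Relation.Nullary.Decidable using (does; ¬?)

Index : Set
Index = List ℕ

_⪯_ : Index → Index → Set
L₁ ⪯ L₂ = Σ Index λ L₃ → L₂ ≡ L₁ ++ L₃

Var : Set
Var = ℕ × Index

_≟V_ : DecidableEquality Var
_≟V_ = ≡-dec ℕP._≟_ (LP.≡-dec ℕP._≟_)

-- Raw terms (terms of 𝓜 are singled out by IsTerm below)

data Term : Set where
  var : Var → Term
  app : Term → Term → Term
  lam : Var → Term → Term

-- free indexed variables (as a list, possibly with repetitions)
fv : Term → List Var
fv (var v)   = v ∷ []
fv (app M N) = fv M ++ fv N
fv (lam v M) = filter (λ w → ¬? (w ≟V v)) (fv M)

deg : Term → Index
deg (var (x , L)) = L
deg (app M N)     = deg M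
deg (lam v M)     = deg M

_⋄_ : Term → Term → Set
M ⋄ N = ∀ x L K → (x , L) ∈ fv M → (x , K) ∈ fv N → L ≡ K

data IsTerm : Term → Set where
  var : ∀ v → IsTerm (var v)
  app : ∀ {M N} → IsTerm M → IsTerm N → deg M ⪯ deg N → M ⋄ N → IsTerm (app M N)
  lam : ∀ {x L M} → IsTerm M → deg M ⪯ L → IsTerm (lam (x , L) M)

lift : ℕ → Term → Term
lift i (var (x , L))   = var (x , i ∷ L)
lift i (app M N)       = app (lift i M) (lift i N)
lift i (lam (x , L) M) = lam (x , i ∷ L) (lift i M)

-- Every binder is renamed to a name fresh for the free variables of the
-- substituted body, so the result is the usual M[x^L := N] up to α.

maxName : List Var → ℕ
maxName = foldr (λ v n → proj₁ v ⊔ n) 0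

ssubst : (Var → Term) → Term → Term
ssubst σ (var v)   = σ v
ssubst σ (app M N) = app (ssubst σ M) (ssubst σ N)
ssubst σ (lam (y , K) P) =
  lam (z , K) (ssubst (λ w → if does (w ≟V (y , K)) then var (z , K) else σ w) P)
  where
    z : ℕ
    z = suc (maxName (concatMap (λ w → fv (σ w)) (fv (lam (y , K) P))))

_[_≔_] : Term → Var → Term → Term
M [ v ≔ N ] = ssubst (λ w → if does (w ≟V v) then N else var w) M

data Ty : Set where
  atom : ℕ → Ty
  _⇒_  : Ty → Ty → Ty
  ω    : Index → Ty
  _⊓_  : Ty → Ty → Ty
  ē    : ℕ → Ty → Ty

infixr 7 _⇒_
infixl 8 _⊓_

degT : Ty → Index
degT (atom a)  = []
degT (U ⇒ T)   = []
degT (ω L)     = L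
degT (U ⊓ V)   = degT U
degT (ē i U)   = i ∷ degT U

-- well-formed types: IsT = 𝕋, WfU = 𝕌 (syntactic representatives)
data IsT : Ty → Set
data WfU : Ty → Set

data IsT where
  atom : ∀ a → IsT (atom a)
  arr  : ∀ {U T} → WfU U → IsT T → IsT (U ⇒ T)

data WfU where
  inT  : ∀ {T} → IsT T → WfU T
  ω    : ∀ L → WfU (ω L)
  _⊓_  : ∀ {U V} → WfU U → WfU V → degT U ≡ degT V → WfU (U ⊓ V)
  ē    : ∀ i {U} → WfU U → WfU (ē i U)

-- the equational theory by which types are taken modulo
infix 4 _≈_
data _≈_ : Ty → Ty → Set where
  ≈-refl  : ∀ {U} → U ≈ U
  ≈-sym   : ∀ {U V} → U ≈ V → V ≈ U
  ≈-trans : ∀ {U V W} → U ≈ V → V ≈ W → U ≈ W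
  ⊓-comm  : ∀ {U V} → degT U ≡ degT V → U ⊓ V ≈ V ⊓ U
  ⊓-assoc : ∀ {U V W} → degT U ≡ degT V → degT V ≡ degT W →
            (U ⊓ V) ⊓ W ≈ U ⊓ (V ⊓ W)
  ⊓-idem  : ∀ {U} → U ⊓ U ≈ U
  ē-dist  : ∀ {i U V} → degT U ≡ degT V → ē i (U ⊓ V) ≈ ē i U ⊓ ē i V
  ω-unit  : ∀ {L U} → degT U ≡ L → ω L ⊓ U ≈ U
  ē-ω     : ∀ {i K} → ē i (ω K) ≈ ω (i ∷ K)
  ⇒-cong  : ∀ {U U' T T'} → U ≈ U' → T ≈ T' → U ⇒ T ≈ U' ⇒ T'
  ⊓-cong  : ∀ {U U' V V'} → U ≈ U' → V ≈ V' → U ⊓ V ≈ U' ⊓ V'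
  ē-cong  : ∀ {i U U'} → U ≈ U' → ē i U ≈ ē i U'

Decl : Set
Decl = Var × Ty

Env : Set
Env = List Decl

dom : Env → List Var
dom = map proj₁

WfEnv : Env → Set
WfEnv Γ = Unique (dom Γ) × All (λ d → WfU (proj₂ d)) Γ

-- Γ , x^L : U  (disjoint union; disjointness is required separately)
_,,_ : Env → Decl → Env
Γ ,, d = d ∷ Γ

envω : Term → Env
envω M = map (λ v → v , ω (proj₂ v)) (deduplicate _≟V_ (fv M))

lookupE : Env → Var → Maybe Ty
lookupE []            v = nothing
lookupE ((w , U) ∷ Γ) v = if does (v ≟V w) then just U else lookupE Γ v

inDom? : Var → Env → Bool
inDom? v Γ with lookupE Γ v
... | just _  = true
... | nothing = false

meetM : Ty → Maybe Ty → Ty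
meetM U (just V) = U ⊓ V
meetM U nothing  = U

_⊓ₑ_ : Env → Env → Env
Γ₁ ⊓ₑ Γ₂ =
  map (λ d → proj₁ d , meetM (proj₂ d) (lookupE Γ₂ (proj₁ d))) Γ₁
  ++ filter (λ d → Data.Bool._≟_ (inDom? (proj₁ d) Γ₁) false) Γ₂

ēₑ : ℕ → Env → Env
ēₑ j = map (λ d → (proj₁ (proj₁ d) , j ∷ proj₂ (proj₁ d)) , ē j (proj₂ d))

_⋄ₑ_ : Env → Env → Set
Γ₁ ⋄ₑ Γ₂ = ∀ x L K → (x , L) ∈ dom Γ₁ → (x , K) ∈ dom Γ₂ → L ≡ K

-- equality of environments (as finite sets of declarations, types modulo ≈)
_≋_ : Env → Env → Set
Γ ≋ Δ = Σ Env λ Θ →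
  Pointwise (λ d d' → proj₁ d ≡ proj₁ d' × proj₂ d ≈ proj₂ d') Γ Θ × Θ ↭ Δ

infix 4 _⊑_ _⊑ₑ_
data _⊑_ : Ty → Ty → Set where
  ⊑-refl  : ∀ {U} → WfU U → U ⊑ U
  ⊑-≈     : ∀ {U V} → WfU U → WfU V → U ≈ V → U ⊑ V
  ⊑-trans : ∀ {U V W} → U ⊑ V → V ⊑ W → U ⊑ W
  ⊓-elim  : ∀ {U₁ U₂} → WfU (U₁ ⊓ U₂) → U₁ ⊓ U₂ ⊑ U₁
  ⊓-mono  : ∀ {U₁ U₂ V₁ V₂} → WfU (U₁ ⊓ U₂) → WfU (V₁ ⊓ V₂) →
            U₁ ⊑ V₁ → U₂ ⊑ V₂ → U₁ ⊓ U₂ ⊑ V₁ ⊓ V₂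
  ⇒-mono  : ∀ {U₁ U₂ T₁ T₂} → WfU (U₁ ⇒ T₁) → WfU (U₂ ⇒ T₂) →
            U₂ ⊑ U₁ → T₁ ⊑ T₂ → U₁ ⇒ T₁ ⊑ U₂ ⇒ T₂
  ē-mono  : ∀ {i U₁ U₂} → U₁ ⊑ U₂ → ē i U₁ ⊑ ē i U₂

data _⊑ₑ_ : Env → Env → Set where
  ⊑ₑ-refl  : ∀ {Γ Δ} → Γ ↭ Δ → Γ ⊑ₑ Δ
  ⊑ₑ-trans : ∀ {Γ Δ Θ} → Γ ⊑ₑ Δ → Δ ⊑ₑ Θ → Γ ⊑ₑ Θ
  ⊑ₑ-point : ∀ {Γ y U₁ U₂} → y ∉ dom Γ → U₁ ⊑ U₂ →
             (Γ ,, (y , U₁)) ⊑ₑ (Γ ,, (y , U₂))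

record Typing : Set where
  constructor ⟨_⊢_⟩
  field
    env : Env
    ty  : Ty

_⊑ₜ_ : Typing → Typing → Set
⟨ Γ₁ ⊢ U₁ ⟩ ⊑ₜ ⟨ Γ₂ ⊢ U₂ ⟩ = U₁ ⊑ U₂ × Γ₂ ⊑ₑ Γ₁

infix 3 _∶_
data _∶_ : Term → Typing → Set where
  ax   : ∀ {x T} → IsT T → var (x , []) ∶ ⟨ ((x , []) , T) ∷ [] ⊢ T ⟩
  ωr   : ∀ {M} → M ∶ ⟨ envω M ⊢ ω (deg M) ⟩
  →I   : ∀ {M Γ x L U T} → IsT T → (x , L) ∉ dom Γ →
         M ∶ ⟨ Γ ,, ((x , L) , U) ⊢ T ⟩ → lam (x , L) M ∶ ⟨ Γ ⊢ U ⇒ T ⟩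
  →I'  : ∀ {M Γ x L T} → IsT T → (x , L) ∉ dom Γ →
         M ∶ ⟨ Γ ⊢ T ⟩ → lam (x , L) M ∶ ⟨ Γ ⊢ ω L ⇒ T ⟩
  →E   : ∀ {M₁ M₂ Γ₁ Γ₂ U T} → IsT T →
         M₁ ∶ ⟨ Γ₁ ⊢ U ⇒ T ⟩ → M₂ ∶ ⟨ Γ₂ ⊢ U ⟩ → Γ₁ ⋄ₑ Γ₂ →
         app M₁ M₂ ∶ ⟨ Γ₁ ⊓ₑ Γ₂ ⊢ T ⟩
  ⊓I   : ∀ {M Γ U₁ U₂} → degT U₁ ≡ degT U₂ →
         M ∶ ⟨ Γ ⊢ U₁ ⟩ → M ∶ ⟨ Γ ⊢ U₂ ⟩ → M ∶ ⟨ Γ ⊢ U₁ ⊓ U₂ ⟩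
  er   : ∀ {M Γ U} j → M ∶ ⟨ Γ ⊢ U ⟩ → lift j M ∶ ⟨ ēₑ j Γ ⊢ ē j U ⟩
  ⊑r   : ∀ {M Γ U Γ' U'} → M ∶ ⟨ Γ ⊢ U ⟩ → ⟨ Γ ⊢ U ⟩ ⊑ₜ ⟨ Γ' ⊢ U' ⟩ →
         M ∶ ⟨ Γ' ⊢ U' ⟩

module Submission where

-- Substitution is capture avoiding: under every binder it renames the bound
-- variable to a fresh name.  An induction on the typing derivation of
-- M[x := N] therefore has to follow a simultaneous substitution σ that sends x
-- to N and acts on the other free variables of M as an injective,
-- index-preserving renaming ρ.  'substitution-inversion' proves the statement
-- for all such σ, relating Γ to Γ₁ and Γ₂ through their lookup functions up to
-- ρ; its application case uses the companion 'renaming-inversion' for the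
-- subterm not containing x.  Lemma 7 is the instance σ = [x := N], ρ = id.

open import Defs
open import Data.Nat using (ℕ; suc; s≤s; _⊔_; _≤_)
open import Data.Bool using (true; false; if_then_else_)
import Data.Bool
open import Data.List using (List; []; _∷_; _++_; map; filter; concatMap; deduplicate)
import Data.List.Properties as ListP
open import Data.List.Membership.Propositional using (_∈_; _∉_)
open import Data.List.Membership.Propositional.Properties
  using (∈-map⁺; ∈-map⁻; ∈-++⁺ˡ; ∈-++⁺ʳ; ∈-++⁻; ∈-∃++; ∈-filter⁻; ∈-filter⁺; ∈-deduplicate⁺; ∈-deduplicate⁻; ∈-concatMap⁺)
open import Data.List.Membership.DecPropositional _≟V_ using () renaming (_∈?_ to _∈?V_)
open import Data.List.Relation.Unary.Any using (here; there)
import Data.List.Relation.Unary.Any as Any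
open import Data.List.Relation.Unary.All using (All; []; _∷_)
import Data.List.Relation.Unary.All as All
import Data.List.Relation.Unary.All.Properties as AllP
open import Data.List.Relation.Unary.Unique.Propositional using (Unique; []; _∷_)
import Data.List.Relation.Unary.Unique.Propositional.Properties as UniqueP
open import Data.List.Relation.Unary.Unique.Propositional.Properties using (Unique[x∷xs]⇒x∉xs)
import Data.List.Relation.Unary.Unique.DecPropositional.Properties as UniqueDecP
open import Data.List.Relation.Binary.Permutation.Propositional using (_↭_; ↭-sym; prep; swap; ↭⇒↭ₛ)
import Data.List.Relation.Binary.Permutation.Propositional as ↭
open import Data.List.Relation.Binary.Permutation.Propositional.Properties using (All-resp-↭; ∈-resp-↭; shift)
import Data.List.Relation.Binary.Permutation.Propositional.Properties as ↭P
import Data.List.Relation.Binary.Permutation.Setoid.Properties as ↭ₛP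
open import Data.List.Relation.Binary.Pointwise using (Pointwise)
import Data.List.Relation.Binary.Pointwise as Pointwise
open import Data.Maybe using (Maybe; just; nothing; fromMaybe)
import Data.Maybe as Maybe
open import Data.Product using (Σ; _×_; _,_; proj₁; proj₂)
open import Data.Sum using (_⊎_; inj₁; inj₂; [_,_]′)
import Data.Sum as Sum
open import Data.Unit using (⊤; tt)
open import Data.Empty using (⊥-elim)
import Data.Nat.Properties as ℕP
open import Relation.Binary.PropositionalEquality
  using (_≡_; refl; sym; trans; cong; cong₂; subst; subst₂; _≢_; setoid; module ≡-Reasoning)
open import Relation.Nullary using (yes; no; ¬_; does)
open import Relation.Nullary.Decidable using (¬?; dec-true; dec-false)
import Relation.Unary

-- Lookup in an environment: the first declaration of a variable wins.

lookup-here : ∀ v U Γ → lookupE ((v , U) ∷ Γ) v ≡ just U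
lookup-here v U Γ rewrite dec-true (v ≟V v) refl = refl

lookup-there : ∀ {v w} U Γ → v ≢ w → lookupE ((w , U) ∷ Γ) v ≡ lookupE Γ v
lookup-there {v} {w} U Γ v≢w rewrite dec-false (v ≟V w) v≢w = refl

lookup-sound : ∀ Γ {v U} → lookupE Γ v ≡ just U → (v , U) ∈ Γ
lookup-sound ((w , A) ∷ Γ) {v} e with v ≟V w
lookup-sound ((w , A) ∷ Γ) {.w} refl | yes refl = here refl
... | no _ = there (lookup-sound Γ e)

lookup-∉ : ∀ Γ {v} → v ∉ dom Γ → lookupE Γ v ≡ nothing
lookup-∉ [] _ = refl
lookup-∉ ((w , A) ∷ Γ) {v} v∉ with v ≟V w
... | yes e = ⊥-elim (v∉ (here e))
... | no _ = lookup-∉ Γ (λ p → v∉ (there p))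

lookup-dom : ∀ Γ {v U} → lookupE Γ v ≡ just U → v ∈ dom Γ
lookup-dom Γ e = ∈-map⁺ proj₁ (lookup-sound Γ e)

dom-lookup : ∀ Γ {v} → v ∈ dom Γ → Σ Ty λ U → lookupE Γ v ≡ just U
dom-lookup ((w , A) ∷ Γ) {v} p with v ≟V w
... | yes _ = A , refl
dom-lookup ((w , A) ∷ Γ) {v} (here e) | no n = ⊥-elim (n e)
dom-lookup ((w , A) ∷ Γ) {v} (there p) | no n = dom-lookup Γ p

lookup-complete : ∀ Γ {v U} → Unique (dom Γ) → (v , U) ∈ Γ → lookupE Γ v ≡ just U
lookup-complete ((w , A) ∷ Γ) u (here refl) = lookup-here w A Γ
lookup-complete ((w , A) ∷ Γ) (w∉ ∷ u) (there p) =
  trans (lookup-there A Γ (λ e → All.lookup w∉ (∈-map⁺ proj₁ p) (sym e))) (lookup-complete Γ u p)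

-- Every environment
-- occurring in a typing derivation is regular (see 'invariant' below).

RegularDecl : Decl → Set
RegularDecl d = WfU (proj₂ d) × degT (proj₂ d) ≡ proj₂ (proj₁ d)

Regular : Env → Set
Regular Γ = Unique (dom Γ) × All RegularDecl Γ

lookup-regular : ∀ Γ {v U} → Regular Γ → lookupE Γ v ≡ just U → WfU U × degT U ≡ proj₂ v
lookup-regular Γ (_ , a) e = All.lookup a (lookup-sound Γ e)

regular-cons : ∀ {Γ v U} → Regular Γ → v ∉ dom Γ → WfU U → degT U ≡ proj₂ v → Regular ((v , U) ∷ Γ)
regular-cons (u , a) v∉ w e = (All.tabulate (λ p e' → v∉ (subst (_∈ _) (sym e') p)) ∷ u) , ((w , e) ∷ a)

regular-tail : ∀ {d Γ} → Regular (d ∷ Γ) → Regular Γ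
regular-tail (_ ∷ u , _ ∷ a) = u , a

regular-head : ∀ {d Γ} → Regular (d ∷ Γ) → RegularDecl d
regular-head (_ , g ∷ _) = g

regular-head∉ : ∀ {v U Γ} → Regular ((v , U) ∷ Γ) → v ∉ dom Γ
regular-head∉ (u , _) = Unique[x∷xs]⇒x∉xs u

≈-deg : ∀ {U V} → U ≈ V → degT U ≡ degT V
≈-deg ≈-refl = refl
≈-deg (≈-sym p) = sym (≈-deg p)
≈-deg (≈-trans p q) = trans (≈-deg p) (≈-deg q)
≈-deg (⊓-comm e) = e
≈-deg (⊓-assoc _ _) = refl
≈-deg ⊓-idem = refl
≈-deg (ē-dist _) = refl
≈-deg (ω-unit e) = sym e
≈-deg ē-ω = refl
≈-deg (⇒-cong _ _) = refl
≈-deg (⊓-cong p _) = ≈-deg p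
≈-deg (ē-cong {i} p) = cong (i ∷_) (≈-deg p)

⊑-deg : ∀ {U V} → U ⊑ V → degT U ≡ degT V
⊑-deg (⊑-refl _) = refl
⊑-deg (⊑-≈ _ _ p) = ≈-deg p
⊑-deg (⊑-trans p q) = trans (⊑-deg p) (⊑-deg q)
⊑-deg (⊓-elim _) = refl
⊑-deg (⊓-mono _ _ p _) = ⊑-deg p
⊑-deg (⇒-mono _ _ _ _) = refl
⊑-deg (ē-mono {i} p) = cong (i ∷_) (⊑-deg p)

⊑-wf : ∀ {U V} → U ⊑ V → WfU U × WfU V
⊑-wf (⊑-refl w) = w , w
⊑-wf (⊑-≈ a b _) = a , b
⊑-wf (⊑-trans p q) = proj₁ (⊑-wf p) , proj₂ (⊑-wf q)
⊑-wf (⊓-elim w@(_⊓_ a _ _)) = w , a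
⊑-wf (⊓-mono a b _ _) = a , b
⊑-wf (⇒-mono a b _ _) = a , b
⊑-wf (ē-mono {i} p) = ē i (proj₁ (⊑-wf p)) , ē i (proj₂ (⊑-wf p))

⊓-elimʳ : ∀ {U V} → WfU U → WfU V → degT U ≡ degT V → U ⊓ V ⊑ V
⊓-elimʳ wU wV e = ⊑-trans (⊑-≈ (_⊓_ wU wV e) (_⊓_ wV wU (sym e)) (⊓-comm e)) (⊓-elim (_⊓_ wV wU (sym e)))

data OptRel (R : Ty → Ty → Set) : Maybe Ty → Maybe Ty → Set where
  none : OptRel R nothing nothing
  some : ∀ {a b} → R a b → OptRel R (just a) (just b)

_≈m_ : Maybe Ty → Maybe Ty → Set
_≈m_ = OptRel _≈_

_⊑m_ : Maybe Ty → Maybe Ty → Set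
_⊑m_ = OptRel _⊑_

-- 'lookupE (Γ₁ ⊓ₑ Γ₂) v' is 'lookupE Γ₁ v ⊓m lookupE Γ₂ v' (see 'lookup-⊓ₑ').
_⊓m_ : Maybe Ty → Maybe Ty → Maybe Ty
just a ⊓m just b = just (a ⊓ b)
just a ⊓m nothing = just a
nothing ⊓m m = m

⊓m-nothing : ∀ m → (m ⊓m nothing) ≡ m
⊓m-nothing nothing = refl
⊓m-nothing (just _) = refl

OptRel-just : ∀ {R : Ty → Ty → Set} {a m} → OptRel R (just a) m → Σ Ty λ b → m ≡ just b × R a b
OptRel-just (some r) = _ , refl , r

OptRel-just⁻ : ∀ {R : Ty → Ty → Set} {b m} → OptRel R m (just b) → Σ Ty λ a → m ≡ just a × R a b
OptRel-just⁻ (some r) = _ , refl , r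

OptRel-nothing : ∀ {R : Ty → Ty → Set} {a} → OptRel R a nothing → a ≡ nothing
OptRel-nothing none = refl

≈m-refl : ∀ {a} → a ≈m a
≈m-refl {nothing} = none
≈m-refl {just _} = some ≈-refl

≈m-sym : ∀ {a b} → a ≈m b → b ≈m a
≈m-sym none = none
≈m-sym (some p) = some (≈-sym p)

≈m-trans : ∀ {a b c} → a ≈m b → b ≈m c → a ≈m c
≈m-trans none none = none
≈m-trans (some p) (some q) = some (≈-trans p q)

≈m-≡ : ∀ {a b} → a ≡ b → a ≈m b
≈m-≡ refl = ≈m-refl

⊑m-trans : ∀ {a b c} → a ⊑m b → b ⊑m c → a ⊑m c
⊑m-trans none none = none
⊑m-trans (some p) (some q) = some (⊑-trans p q)

-- An optional type that, if present, has degree L.  The laws of ⊓ need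
-- equal degrees, so the algebra of ⊓m is stated under this hypothesis.
data OptDeg (L : Index) : Maybe Ty → Set where
  absent : OptDeg L nothing
  present : ∀ {a} → degT a ≡ L → OptDeg L (just a)

OptDeg-⊓ : ∀ {L a b} → OptDeg L a → OptDeg L b → OptDeg L (a ⊓m b)
OptDeg-⊓ absent q = q
OptDeg-⊓ (present e) absent = present e
OptDeg-⊓ (present e) (present _) = present e

OptDeg-shift : ∀ {L L' m} → L ≡ L' → OptDeg L m → OptDeg L' m
OptDeg-shift refl d = d

⊓m-cong : ∀ {a a' b b'} → a ≈m a' → b ≈m b' → (a ⊓m b) ≈m (a' ⊓m b')
⊓m-cong none q = q
⊓m-cong (some p) none = some p
⊓m-cong (some p) (some q) = some (⊓-cong p q)

⊓m-idem : ∀ {a} → (a ⊓m a) ≈m a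
⊓m-idem {nothing} = none
⊓m-idem {just _} = some ⊓-idem

⊓m-comm : ∀ {L a b} → OptDeg L a → OptDeg L b → (a ⊓m b) ≈m (b ⊓m a)
⊓m-comm absent absent = none
⊓m-comm absent (present _) = ≈m-refl
⊓m-comm (present _) absent = ≈m-refl
⊓m-comm (present e) (present e') = some (⊓-comm (trans e (sym e')))

⊓m-assoc : ∀ {L a b c} → OptDeg L a → OptDeg L b → OptDeg L c → ((a ⊓m b) ⊓m c) ≈m (a ⊓m (b ⊓m c))
⊓m-assoc absent _ _ = ≈m-refl
⊓m-assoc (present _) absent _ = ≈m-refl
⊓m-assoc (present _) (present _) absent = ≈m-refl
⊓m-assoc (present e) (present e') (present e'') = some (⊓-assoc (trans e (sym e')) (trans e' (sym e'')))

⊓m-swap : ∀ {L a b c} → OptDeg L a → OptDeg L b → OptDeg L c → ((a ⊓m b) ⊓m c) ≈m ((a ⊓m c) ⊓m b)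
⊓m-swap {a = a} da db dc =
  ≈m-trans (⊓m-assoc da db dc)
  (≈m-trans (⊓m-cong (≈m-refl {a}) (⊓m-comm db dc)) (≈m-sym (⊓m-assoc da dc db)))

⊓m-interchange : ∀ {L a b c d} → OptDeg L a → OptDeg L b → OptDeg L c → OptDeg L d →
                 ((a ⊓m b) ⊓m (c ⊓m d)) ≈m ((a ⊓m c) ⊓m (b ⊓m d))
⊓m-interchange {a = a} {d = d} da db dc dd =
  ≈m-trans (⊓m-assoc da db (OptDeg-⊓ dc dd))
  (≈m-trans (⊓m-cong (≈m-refl {a}) (≈m-sym (⊓m-assoc db dc dd)))
  (≈m-trans (⊓m-cong (≈m-refl {a}) (⊓m-cong (⊓m-comm db dc) (≈m-refl {d})))
  (≈m-trans (⊓m-cong (≈m-refl {a}) (⊓m-assoc dc db dd))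
  (≈m-sym (⊓m-assoc da dc (OptDeg-⊓ db dd))))))

mapē-⊓m : ∀ {j L a b} → OptDeg L a → OptDeg L b →
          Maybe.map (ē j) (a ⊓m b) ≈m (Maybe.map (ē j) a ⊓m Maybe.map (ē j) b)
mapē-⊓m absent absent = none
mapē-⊓m absent (present _) = some ≈-refl
mapē-⊓m (present _) absent = some ≈-refl
mapē-⊓m (present e) (present e') = some (ē-dist (trans e (sym e')))

≈m-mapē : ∀ {j a b} → a ≈m b → Maybe.map (ē j) a ≈m Maybe.map (ē j) b
≈m-mapē none = none
≈m-mapē (some p) = some (ē-cong p)

⊓m-elimˡ : ∀ {D A m} → WfU D → WfU A → (∀ {B} → m ≡ just B → WfU B × degT B ≡ degT A) →
  just D ≈m (just A ⊓m m) → D ⊑ A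
⊓m-elimˡ {m = nothing} wD wA h (some p) = ⊑-≈ wD wA p
⊓m-elimˡ {m = just B} wD wA h (some p) = ⊑-trans (⊑-≈ wD wAB p) (⊓-elim wAB)
  where wAB = _⊓_ wA (proj₁ (h refl)) (sym (proj₂ (h refl)))

⊓m-elimʳ : ∀ {D B m} → WfU D → WfU B → (∀ {A} → m ≡ just A → WfU A × degT A ≡ degT B) →
  just D ≈m (m ⊓m just B) → D ⊑ B
⊓m-elimʳ {m = nothing} wD wB h (some p) = ⊑-≈ wD wB p
⊓m-elimʳ {m = just A} wD wB h (some p) =
  ⊑-trans (⊑-≈ wD (_⊓_ wA wB eAB) p) (⊓-elimʳ wA wB eAB)
  where wA = proj₁ (h refl)
        eAB = proj₂ (h refl)

lookup-deg : ∀ Γ v → Regular Γ → OptDeg (proj₂ v) (lookupE Γ v)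
lookup-deg Γ v g with lookupE Γ v in e
... | nothing = absent
... | just a = present (proj₂ (lookup-regular Γ g e))

⊑m-refl : ∀ {Γ} → Regular Γ → ∀ v → lookupE Γ v ⊑m lookupE Γ v
⊑m-refl {Γ} g v with lookupE Γ v in e
... | nothing = none
... | just A = some (⊑-refl (proj₁ (lookup-regular Γ g e)))

-- Environments are determined by their lookup function.  The relations ≋ and
-- ⊑ₑ of the calculus are defined syntactically (up to permutation), so we show
-- that for regular environments they follow from pointwise comparison of lookups.

mapE : (Var → Ty → Ty) → Env → Env
mapE f [] = []
mapE f ((v , A) ∷ Γ) = (v , f v A) ∷ mapE f Γ

dom-mapE : ∀ f Γ → dom (mapE f Γ) ≡ dom Γ
dom-mapE f [] = refl
dom-mapE f ((v , A) ∷ Γ) = cong (v ∷_) (dom-mapE f Γ)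

∈-mapE⁺ : ∀ f Γ {v A} → (v , A) ∈ Γ → (v , f v A) ∈ mapE f Γ
∈-mapE⁺ f ((w , B) ∷ Γ) (here refl) = here refl
∈-mapE⁺ f ((w , B) ∷ Γ) (there p) = there (∈-mapE⁺ f Γ p)

∈-mapE⁻ : ∀ f Γ {v C} → (v , C) ∈ mapE f Γ → Σ Ty λ A → (v , A) ∈ Γ × C ≡ f v A
∈-mapE⁻ f ((w , B) ∷ Γ) (here refl) = B , here refl , refl
∈-mapE⁻ f ((w , B) ∷ Γ) (there p) with ∈-mapE⁻ f Γ p
... | A , q , e = A , there q , e

lookup-mapE : ∀ f Γ v → lookupE (mapE f Γ) v ≡ Maybe.map (f v) (lookupE Γ v)
lookup-mapE f [] v = refl
lookup-mapE f ((w , A) ∷ Γ) v with v ≟V w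
... | yes refl = refl
... | no _ = lookup-mapE f Γ v

regular-mapE : ∀ f Γ → Regular Γ → (∀ {v A} → (v , A) ∈ Γ → RegularDecl (v , f v A)) → Regular (mapE f Γ)
regular-mapE f Γ (u , _) h = subst Unique (sym (dom-mapE f Γ)) u , All.tabulate regularAt
  where
  regularAt : ∀ {d} → d ∈ mapE f Γ → RegularDecl d
  regularAt {v , C} p with ∈-mapE⁻ f Γ p
  ... | A , q , refl = h q

Unique-resp-↭ : ∀ {A : Set} {xs ys : List A} → xs ↭ ys → Unique xs → Unique ys
Unique-resp-↭ {A} p = ↭ₛP.Unique-resp-↭ (setoid A) (↭⇒↭ₛ p)

unique-↭ : ∀ {A : Set} (xs ys : List A) → Unique xs → Unique ys →
           (∀ {z} → z ∈ xs → z ∈ ys) → (∀ {z} → z ∈ ys → z ∈ xs) → xs ↭ ys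
unique-↭ [] [] _ _ _ _ = ↭.refl
unique-↭ [] (y ∷ ys) _ _ _ ys⊆xs with ys⊆xs (here refl)
... | ()
unique-↭ (x ∷ xs) ys (x∉xs ∷ uxs) uys xs⊆ys ys⊆xs with ∈-∃++ (xs⊆ys (here refl))
... | ys₁ , ys₂ , refl =
  ↭.trans (prep x (unique-↭ xs (ys₁ ++ ys₂) uxs (tail u) xs⊆ys' ys⊆xs')) (↭-sym (shift x ys₁ ys₂))
  where
  u : Unique (x ∷ ys₁ ++ ys₂)
  u = Unique-resp-↭ (shift x ys₁ ys₂) uys
  tail : Unique (x ∷ ys₁ ++ ys₂) → Unique (ys₁ ++ ys₂)
  tail (_ ∷ u') = u'
  xs⊆ys' : ∀ {z} → z ∈ xs → z ∈ ys₁ ++ ys₂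
  xs⊆ys' {z} p with ∈-++⁻ ys₁ (xs⊆ys (there p))
  ... | inj₁ q = ∈-++⁺ˡ q
  ... | inj₂ (here refl) = ⊥-elim (All.lookup x∉xs p refl)
  ... | inj₂ (there q) = ∈-++⁺ʳ ys₁ q
  ys⊆xs' : ∀ {z} → z ∈ ys₁ ++ ys₂ → z ∈ xs
  ys⊆xs' {z} p with ys⊆xs (∈-resp-↭ (↭-sym (shift x ys₁ ys₂)) (there p))
  ... | here refl = ⊥-elim (Unique[x∷xs]⇒x∉xs u p)
  ... | there q = q

-- Γ retyped with the types Δ assigns; when Γ and Δ have the same domain this
-- is a permutation of Δ that follows Γ's order.
retype : Env → Env → Env
retype Δ Γ = mapE (λ v A → fromMaybe A (lookupE Δ v)) Γ

retype-↭ : ∀ {R : Ty → Ty → Set} Γ Δ → Unique (dom Γ) → Unique (dom Δ) →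
           (∀ v → OptRel R (lookupE Γ v) (lookupE Δ v)) → retype Δ Γ ↭ Δ
retype-↭ {R} Γ Δ uΓ uΔ h =
  unique-↭ (retype Δ Γ) Δ (UniqueP.map⁻ (subst Unique (sym (dom-mapE _ Γ)) uΓ)) (UniqueP.map⁻ uΔ) ⊆Δ Δ⊆
  where
  ⊆Δ : ∀ {z} → z ∈ retype Δ Γ → z ∈ Δ
  ⊆Δ {v , C} p with ∈-mapE⁻ _ Γ p
  ... | A , q , refl with lookupE Δ v in eΔ | h v
  ... | just B | _ = lookup-sound Δ eΔ
  ... | nothing | r with subst (λ a → OptRel R a nothing) (lookup-complete Γ uΓ q) r
  ... | ()
  Δ⊆ : ∀ {z} → z ∈ Δ → z ∈ retype Δ Γ
  Δ⊆ {v , B} p with lookupE Γ v in eΓ | subst (OptRel R (lookupE Γ v)) (lookup-complete Δ uΔ p) (h v)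
  ... | just A | _ = subst (λ m → (v , fromMaybe A m) ∈ retype Δ Γ) (lookup-complete Δ uΔ p)
                       (∈-mapE⁺ _ Γ (lookup-sound Γ eΓ))
  ... | nothing | ()

retype-related : ∀ {R : Ty → Ty → Set} Γ Δ → Unique (dom Γ) → (∀ v → OptRel R (lookupE Γ v) (lookupE Δ v)) →
                 ∀ {v A} → (v , A) ∈ Γ → R A (fromMaybe A (lookupE Δ v))
retype-related {R} Γ Δ u h {v} {A} p = related (subst (λ a → OptRel R a (lookupE Δ v)) (lookup-complete Γ u p) (h v))
  where
  related : ∀ {m} → OptRel R (just A) m → R A (fromMaybe A m)
  related (some r) = r

pointwise⇒≋ : ∀ {Γ Δ} → Regular Γ → Regular Δ → (∀ v → lookupE Γ v ≈m lookupE Δ v) → Γ ≋ Δ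
pointwise⇒≋ {Γ} {Δ} (u , _) (u' , _) h = retype Δ Γ , pointwise Γ (retype-related Γ Δ u h) , retype-↭ Γ Δ u u' h
  where
  pointwise : ∀ Γ' → (∀ {v A} → (v , A) ∈ Γ' → A ≈ fromMaybe A (lookupE Δ v)) →
              Pointwise (λ d d' → proj₁ d ≡ proj₁ d' × proj₂ d ≈ proj₂ d') Γ' (retype Δ Γ')
  pointwise [] h' = Pointwise.[]
  pointwise ((v , A) ∷ Γ') h' = (refl , h' (here refl)) Pointwise.∷ pointwise Γ' (λ p → h' (there p))

-- ... and ⊑ₑ.  The proof weakens declaration by declaration ('⊑ₑ-point'),
-- which needs the congruence of ⊑ₑ under adding a declaration.

⊑ₑ-dom⁻ : ∀ {Γ Δ w} → Γ ⊑ₑ Δ → w ∈ dom Δ → w ∈ dom Γ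
⊑ₑ-dom⁻ (⊑ₑ-refl p) q = ∈-resp-↭ (↭P.map⁺ proj₁ (↭-sym p)) q
⊑ₑ-dom⁻ (⊑ₑ-trans p r) q = ⊑ₑ-dom⁻ p (⊑ₑ-dom⁻ r q)
⊑ₑ-dom⁻ (⊑ₑ-point _ _) (here e) = here e
⊑ₑ-dom⁻ (⊑ₑ-point _ _) (there q) = there q

⊑ₑ-dom⁺ : ∀ {Γ Δ w} → Γ ⊑ₑ Δ → w ∈ dom Γ → w ∈ dom Δ
⊑ₑ-dom⁺ (⊑ₑ-refl p) q = ∈-resp-↭ (↭P.map⁺ proj₁ p) q
⊑ₑ-dom⁺ (⊑ₑ-trans p r) q = ⊑ₑ-dom⁺ r (⊑ₑ-dom⁺ p q)
⊑ₑ-dom⁺ (⊑ₑ-point _ _) (here e) = here e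
⊑ₑ-dom⁺ (⊑ₑ-point _ _) (there q) = there q

⊑ₑ-cons : ∀ {Γ Δ v B} → v ∉ dom Γ → Γ ⊑ₑ Δ → ((v , B) ∷ Γ) ⊑ₑ ((v , B) ∷ Δ)
⊑ₑ-cons v∉ (⊑ₑ-refl p) = ⊑ₑ-refl (prep _ p)
⊑ₑ-cons v∉ (⊑ₑ-trans p q) = ⊑ₑ-trans (⊑ₑ-cons v∉ p) (⊑ₑ-cons (λ r → v∉ (⊑ₑ-dom⁻ p r)) q)
⊑ₑ-cons v∉ (⊑ₑ-point y∉ s) =
  ⊑ₑ-trans (⊑ₑ-refl (swap _ _ ↭.refl)) (⊑ₑ-trans (⊑ₑ-point y∉' s) (⊑ₑ-refl (swap _ _ ↭.refl)))
  where
  y∉' : _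
  y∉' (here e) = v∉ (here (sym e))
  y∉' (there p) = y∉ p

mapE-⊑ₑ : ∀ f Γ → Unique (dom Γ) → (∀ {v A} → (v , A) ∈ Γ → A ⊑ f v A) → Γ ⊑ₑ mapE f Γ
mapE-⊑ₑ f [] _ _ = ⊑ₑ-refl ↭.refl
mapE-⊑ₑ f ((v , A) ∷ Γ) u@(_ ∷ u') h =
  ⊑ₑ-trans (⊑ₑ-point (Unique[x∷xs]⇒x∉xs u) (h (here refl)))
           (⊑ₑ-cons (Unique[x∷xs]⇒x∉xs u) (mapE-⊑ₑ f Γ u' (λ p → h (there p))))

pointwise⇒⊑ₑ : ∀ {Γ Γ'} → Regular Γ → Regular Γ' → (∀ v → lookupE Γ' v ⊑m lookupE Γ v) → Γ' ⊑ₑ Γ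
pointwise⇒⊑ₑ {Γ} {Γ'} (u , _) (u' , _) h =
  ⊑ₑ-trans (mapE-⊑ₑ _ Γ' u' (retype-related Γ' Γ u' h)) (⊑ₑ-refl (retype-↭ Γ' Γ u' u h))

weaken-env : ∀ {M Γ Γ' U} → M ∶ ⟨ Γ ⊢ U ⟩ → Regular Γ → Regular Γ' → WfU U →
             (∀ v → lookupE Γ' v ⊑m lookupE Γ v) → M ∶ ⟨ Γ' ⊢ U ⟩
weaken-env d g g' w h = ⊑r d (⊑-refl w , pointwise⇒⊑ₑ g g' h)

⊑ₑ-regular : ∀ {Γ' Γ} → Γ' ⊑ₑ Γ → Regular Γ → Regular Γ'
⊑ₑ-regular (⊑ₑ-refl p) (u , a) = Unique-resp-↭ (↭P.map⁺ proj₁ (↭-sym p)) u , All-resp-↭ (↭-sym p) a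
⊑ₑ-regular (⊑ₑ-trans p q) g = ⊑ₑ-regular p (⊑ₑ-regular q g)
⊑ₑ-regular (⊑ₑ-point _ s) (u , (_ , d) ∷ a) = u , (proj₁ (⊑-wf s) , trans (⊑-deg s) d) ∷ a

lookup-↭ : ∀ {Γ Δ} → Unique (dom Γ) → Γ ↭ Δ → ∀ v → lookupE Γ v ≡ lookupE Δ v
lookup-↭ {Γ} {Δ} u p v with lookupE Γ v in eΓ | lookupE Δ v in eΔ
... | just A | _ = trans (sym (lookup-complete Δ uΔ (∈-resp-↭ p (lookup-sound Γ eΓ)))) eΔ
  where uΔ = Unique-resp-↭ (↭P.map⁺ proj₁ p) u
... | nothing | nothing = refl
... | nothing | just B with dom-lookup Γ (∈-map⁺ proj₁ (∈-resp-↭ (↭-sym p) (lookup-sound Δ eΔ)))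
... | A , eA with trans (sym eΓ) eA
... | ()

⊑ₑ-lookup : ∀ {Γ' Γ} → Γ' ⊑ₑ Γ → Regular Γ → ∀ v → lookupE Γ' v ⊑m lookupE Γ v
⊑ₑ-lookup (⊑ₑ-refl p) g v =
  subst (λ m → m ⊑m _) (sym (lookup-↭ (proj₁ (⊑ₑ-regular (⊑ₑ-refl p) g)) p v)) (⊑m-refl g v)
⊑ₑ-lookup (⊑ₑ-trans p q) g v = ⊑m-trans (⊑ₑ-lookup p (⊑ₑ-regular q g) v) (⊑ₑ-lookup q g v)
⊑ₑ-lookup (⊑ₑ-point {y = y} _ s) g v with v ≟V y
... | yes refl = some s
... | no _ = ⊑m-refl (regular-tail g) v

private
  notIn? : (Γ₁ : Env) → Relation.Unary.Decidable (λ (d : Decl) → inDom? (proj₁ d) Γ₁ ≡ false)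
  notIn? Γ₁ d = Data.Bool._≟_ (inDom? (proj₁ d) Γ₁) false

  meetWith : Env → Decl → Decl
  meetWith Γ₂ d = proj₁ d , meetM (proj₂ d) (lookupE Γ₂ (proj₁ d))

lookup-++ : ∀ xs ys v → lookupE (xs ++ ys) v ≡ (lookupE xs v Maybe.<∣> lookupE ys v)
lookup-++ [] ys v = refl
lookup-++ ((w , A) ∷ xs) ys v with v ≟V w
... | yes _ = refl
... | no _ = lookup-++ xs ys v

inDom?-false : ∀ Γ v → lookupE Γ v ≡ nothing → inDom? v Γ ≡ false
inDom?-false Γ v e with lookupE Γ v
... | nothing = refl

inDom?-true : ∀ Γ v {a} → lookupE Γ v ≡ just a → inDom? v Γ ≡ true
inDom?-true Γ v e with lookupE Γ v
inDom?-true Γ v refl | just _ = refl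

lookup-map-meet : ∀ Γ₁ Γ₂ v →
  lookupE (map (meetWith Γ₂) Γ₁) v ≡ Maybe.map (λ U → meetM U (lookupE Γ₂ v)) (lookupE Γ₁ v)
lookup-map-meet [] Γ₂ v = refl
lookup-map-meet ((w , A) ∷ Γ₁) Γ₂ v with v ≟V w
... | yes refl = refl
... | no _ = lookup-map-meet Γ₁ Γ₂ v

lookup-filter-notIn : ∀ Γ₁ Γ₂ v → lookupE Γ₁ v ≡ nothing → lookupE (filter (notIn? Γ₁) Γ₂) v ≡ lookupE Γ₂ v
lookup-filter-notIn Γ₁ [] v e = refl
lookup-filter-notIn Γ₁ ((w , A) ∷ Γ₂) v e with v ≟V w
lookup-filter-notIn Γ₁ ((w , A) ∷ Γ₂) .w e | yes refl rewrite inDom?-false Γ₁ w e =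
  lookup-here w A (filter (notIn? Γ₁) Γ₂)
... | no v≢w with does (notIn? Γ₁ (w , A))
... | true = trans (lookup-there A (filter (notIn? Γ₁) Γ₂) v≢w) (lookup-filter-notIn Γ₁ Γ₂ v e)
... | false = lookup-filter-notIn Γ₁ Γ₂ v e

lookup-⊓ₑ : ∀ Γ₁ Γ₂ v → lookupE (Γ₁ ⊓ₑ Γ₂) v ≡ lookupE Γ₁ v ⊓m lookupE Γ₂ v
lookup-⊓ₑ Γ₁ Γ₂ v rewrite lookup-++ (map (meetWith Γ₂) Γ₁) (filter (notIn? Γ₁) Γ₂) v
  | lookup-map-meet Γ₁ Γ₂ v with lookupE Γ₁ v in e₁
... | just a with lookupE Γ₂ v
... | just b = refl
... | nothing = refl
lookup-⊓ₑ Γ₁ Γ₂ v | nothing = lookup-filter-notIn Γ₁ Γ₂ v e₁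

dom-filter-⊆ : ∀ {P : Decl → Set} (P? : Relation.Unary.Decidable P) Γ {z} → z ∈ dom (filter P? Γ) → z ∈ dom Γ
dom-filter-⊆ P? Γ p with ∈-map⁻ proj₁ p
... | d , q , refl = ∈-map⁺ proj₁ (proj₁ (∈-filter⁻ P? {xs = Γ} q))

unique-dom-filter : ∀ {P : Decl → Set} (P? : Relation.Unary.Decidable P) Γ →
                    Unique (dom Γ) → Unique (dom (filter P? Γ))
unique-dom-filter P? [] u = []
unique-dom-filter P? (d ∷ Γ) (d∉ ∷ u) with does (P? d)
... | true = All.tabulate (λ p → All.lookup d∉ (dom-filter-⊆ P? Γ p)) ∷ unique-dom-filter P? Γ u
... | false = unique-dom-filter P? Γ u

regular-⊓ₑ : ∀ Γ₁ Γ₂ → Regular Γ₁ → Regular Γ₂ → Regular (Γ₁ ⊓ₑ Γ₂)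
regular-⊓ₑ Γ₁ Γ₂ (u₁ , a₁) g₂@(u₂ , a₂) = unique , AllP.++⁺ (AllP.map⁺ (All.tabulate met)) (AllP.filter⁺ (notIn? Γ₁) a₂)
  where
  dom-meet : ∀ Γ → dom (map (meetWith Γ₂) Γ) ≡ dom Γ
  dom-meet [] = refl
  dom-meet (d ∷ Γ) = cong (proj₁ d ∷_) (dom-meet Γ)
  disjoint : ∀ {z} → ¬ (z ∈ dom (map (meetWith Γ₂) Γ₁) × z ∈ dom (filter (notIn? Γ₁) Γ₂))
  disjoint {z} (p , q) with ∈-map⁻ proj₁ q
  ... | d , q' , refl with dom-lookup Γ₁ (subst (z ∈_) (dom-meet Γ₁) p)
  ... | A , e with trans (sym (inDom?-true Γ₁ z e)) (proj₂ (∈-filter⁻ (notIn? Γ₁) {xs = Γ₂} q'))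
  ... | ()
  unique : Unique (dom (Γ₁ ⊓ₑ Γ₂))
  unique = subst Unique (sym (ListP.map-++ proj₁ (map (meetWith Γ₂) Γ₁) (filter (notIn? Γ₁) Γ₂)))
    (UniqueP.++⁺ (subst Unique (sym (dom-meet Γ₁)) u₁) (unique-dom-filter (notIn? Γ₁) Γ₂ u₂) disjoint)
  met : ∀ {d} → d ∈ Γ₁ → RegularDecl (meetWith Γ₂ d)
  met {(w , A)} p with All.lookup a₁ p | lookupE Γ₂ w in e
  ... | r | nothing = r
  ... | (wA , dA) | just B with lookup-regular Γ₂ g₂ e
  ... | (wB , dB) = (_⊓_ wA wB (trans dA (sym dB))) , dA

dom-⊓ₑ⁻ : ∀ Γ₁ Γ₂ {v} → v ∈ dom (Γ₁ ⊓ₑ Γ₂) → v ∈ dom Γ₁ ⊎ v ∈ dom Γ₂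
dom-⊓ₑ⁻ Γ₁ Γ₂ {v} p with dom-lookup (Γ₁ ⊓ₑ Γ₂) p
... | A , e = split (lookupE Γ₁ v) (lookupE Γ₂ v) refl refl (trans (sym (lookup-⊓ₑ Γ₁ Γ₂ v)) e)
  where
  split : ∀ m₁ m₂ → lookupE Γ₁ v ≡ m₁ → lookupE Γ₂ v ≡ m₂ → m₁ ⊓m m₂ ≡ just A → v ∈ dom Γ₁ ⊎ v ∈ dom Γ₂
  split (just a) _ e₁ _ _ = inj₁ (lookup-dom Γ₁ e₁)
  split nothing (just b) _ e₂ _ = inj₂ (lookup-dom Γ₂ e₂)

dom-⊓ₑ⁺ : ∀ Γ₁ Γ₂ {v} → v ∈ dom Γ₁ ⊎ v ∈ dom Γ₂ → v ∈ dom (Γ₁ ⊓ₑ Γ₂)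
dom-⊓ₑ⁺ Γ₁ Γ₂ {v} p = lookup-dom (Γ₁ ⊓ₑ Γ₂) (trans (lookup-⊓ₑ Γ₁ Γ₂ v) (proj₂ (meet-defined p)))
  where
  meet-defined : v ∈ dom Γ₁ ⊎ v ∈ dom Γ₂ → Σ Ty λ C → lookupE Γ₁ v ⊓m lookupE Γ₂ v ≡ just C
  meet-defined (inj₁ q) with dom-lookup Γ₁ q
  ... | A , e rewrite e with lookupE Γ₂ v
  ... | just B = A ⊓ B , refl
  ... | nothing = A , refl
  meet-defined (inj₂ q) with dom-lookup Γ₂ q
  ... | B , e rewrite e with lookupE Γ₁ v
  ... | just A = A ⊓ B , refl
  ... | nothing = B , refl

meet-⊑ˡ : ∀ Γa Γb → Regular Γa → Regular Γb → (∀ {v} → v ∈ dom Γb → v ∈ dom Γa) →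
          ∀ v → lookupE (Γa ⊓ₑ Γb) v ⊑m lookupE Γa v
meet-⊑ˡ Γa Γb ga gb ba v rewrite lookup-⊓ₑ Γa Γb v with lookupE Γa v in ea | lookupE Γb v in eb
... | just A | just B = some (⊓-elim (_⊓_ (proj₁ ra) (proj₁ rb) (trans (proj₂ ra) (sym (proj₂ rb)))))
  where ra = lookup-regular Γa ga ea
        rb = lookup-regular Γb gb eb
... | just A | nothing = some (⊑-refl (proj₁ (lookup-regular Γa ga ea)))
... | nothing | nothing = none
... | nothing | just B with dom-lookup Γa (ba (lookup-dom Γb eb))
... | A , e with trans (sym ea) e
... | ()

meet-⊑ʳ : ∀ Γa Γb → Regular Γa → Regular Γb → (∀ {v} → v ∈ dom Γa → v ∈ dom Γb) →
          ∀ v → lookupE (Γa ⊓ₑ Γb) v ⊑m lookupE Γb v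
meet-⊑ʳ Γa Γb ga gb ab v rewrite lookup-⊓ₑ Γa Γb v with lookupE Γa v in ea | lookupE Γb v in eb
... | just A | just B = some (⊓-elimʳ (proj₁ ra) (proj₁ rb) (trans (proj₂ ra) (sym (proj₂ rb))))
  where ra = lookup-regular Γa ga ea
        rb = lookup-regular Γb gb eb
... | nothing | just B = some (⊑-refl (proj₁ (lookup-regular Γb gb eb)))
... | nothing | nothing = none
... | just A | nothing with dom-lookup Γb (ab (lookup-dom Γa ea))
... | B , e with trans (sym eb) e
... | ()

rem : Var → Env → Env
rem y Γ = filter (λ d → ¬? (proj₁ d ≟V y)) Γ

lookup-rem : ∀ y Γ {v} → v ≢ y → lookupE (rem y Γ) v ≡ lookupE Γ v
lookup-rem y [] v≢y = refl
lookup-rem y ((w , A) ∷ Γ) {v} v≢y with w ≟V y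
... | yes refl = sym (trans (lookup-there A Γ v≢y) (sym (lookup-rem y Γ v≢y)))
... | no _ with v ≟V w
... | yes refl = refl
... | no _ = lookup-rem y Γ v≢y

rem-∉ : ∀ y Γ → y ∉ dom (rem y Γ)
rem-∉ y Γ p with ∈-map⁻ proj₁ p
... | d , q , refl = proj₂ (∈-filter⁻ (λ d → ¬? (proj₁ d ≟V y)) {xs = Γ} q) refl

rem-dom : ∀ y Γ {v} → v ∈ dom (rem y Γ) → v ∈ dom Γ
rem-dom y Γ p = dom-filter-⊆ (λ d → ¬? (proj₁ d ≟V y)) Γ p

regular-rem : ∀ y Γ → Regular Γ → Regular (rem y Γ)
regular-rem y Γ (u , a) =
  unique-dom-filter (λ d → ¬? (proj₁ d ≟V y)) Γ u , AllP.filter⁺ (λ d → ¬? (proj₁ d ≟V y)) a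

rem-cons : ∀ {y w} A Γ → w ≢ y → rem y ((w , A) ∷ Γ) ≡ (w , A) ∷ rem y Γ
rem-cons {y} {w} A Γ w≢y rewrite dec-false (w ≟V y) w≢y = refl

private
  dom-envω : ∀ M → dom (envω M) ≡ deduplicate _≟V_ (fv M)
  dom-envω M = dom-pairs (deduplicate _≟V_ (fv M))
    where
    dom-pairs : ∀ xs → dom (map (λ v → v , ω (proj₂ v)) xs) ≡ xs
    dom-pairs [] = refl
    dom-pairs (x ∷ xs) = cong (x ∷_) (dom-pairs xs)

regular-envω : ∀ M → Regular (envω M)
regular-envω M =
  subst Unique (sym (dom-envω M)) (UniqueDecP.deduplicate-! _≟V_ (fv M)) , All.tabulate regularAt
  where
  regularAt : ∀ {d} → d ∈ envω M → RegularDecl d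
  regularAt p with ∈-map⁻ (λ v → v , ω (proj₂ v)) p
  ... | v , _ , refl = ω (proj₂ v) , refl

envω-dom⁺ : ∀ M {v} → v ∈ fv M → v ∈ dom (envω M)
envω-dom⁺ M p = subst (_ ∈_) (sym (dom-envω M)) (∈-deduplicate⁺ _≟V_ p)

envω-dom⁻ : ∀ M {v} → v ∈ dom (envω M) → v ∈ fv M
envω-dom⁻ M p = ∈-deduplicate⁻ _≟V_ (fv M) (subst (_ ∈_) (dom-envω M) p)

lookup-envω⁺ : ∀ M {v} → v ∈ fv M → lookupE (envω M) v ≡ just (ω (proj₂ v))
lookup-envω⁺ M p = lookup-complete (envω M) (proj₁ (regular-envω M))
  (∈-map⁺ (λ v → v , ω (proj₂ v)) (∈-deduplicate⁺ _≟V_ p))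

lookup-envω⁻ : ∀ M {v} → v ∉ fv M → lookupE (envω M) v ≡ nothing
lookup-envω⁻ M v∉ = lookup-∉ (envω M) (λ p → v∉ (envω-dom⁻ M p))

liftV : ℕ → Var → Var
liftV j (n , L) = (n , j ∷ L)

liftV-injective : ∀ {j v w} → liftV j v ≡ liftV j w → v ≡ w
liftV-injective {j} {n , L} {.n , .L} refl = refl

deg-lift : ∀ j M → deg (lift j M) ≡ j ∷ deg M
deg-lift j (var (n , L)) = refl
deg-lift j (app M N) = deg-lift j M
deg-lift j (lam (n , L) M) = deg-lift j M

fv-lift : ∀ j M → fv (lift j M) ≡ map (liftV j) (fv M)
fv-lift j (var (n , L)) = refl
fv-lift j (app M N) rewrite fv-lift j M | fv-lift j N = sym (ListP.map-++ (liftV j) (fv M) (fv N))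
fv-lift j (lam y M) rewrite fv-lift j M = filter-lift y (fv M)
  where
  filter-lift : ∀ y xs → filter (λ w → ¬? (w ≟V liftV j y)) (map (liftV j) xs)
                         ≡ map (liftV j) (filter (λ w → ¬? (w ≟V y)) xs)
  filter-lift y [] = refl
  filter-lift y (w ∷ xs) with liftV j w ≟V liftV j y | w ≟V y
  ... | yes _ | yes _ = filter-lift y xs
  ... | no _ | no _ = cong (liftV j w ∷_) (filter-lift y xs)
  ... | yes e | no n = ⊥-elim (n (liftV-injective e))
  ... | no n | yes e = ⊥-elim (n (cong (liftV j) e))

fv-lift⁻ : ∀ j M {w} → w ∈ fv (lift j M) → Σ Var λ w₀ → w₀ ∈ fv M × w ≡ liftV j w₀
fv-lift⁻ j M p with ∈-map⁻ (liftV j) (subst (_ ∈_) (fv-lift j M) p)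
... | w₀ , q , e = w₀ , q , e

fv-lift⁺ : ∀ j M {w₀} → w₀ ∈ fv M → liftV j w₀ ∈ fv (lift j M)
fv-lift⁺ j M p = subst (_ ∈_) (sym (fv-lift j M)) (∈-map⁺ (liftV j) p)

dom-ēₑ : ∀ j Γ → dom (ēₑ j Γ) ≡ map (liftV j) (dom Γ)
dom-ēₑ j [] = refl
dom-ēₑ j (((n , L) , A) ∷ Γ) = cong ((n , j ∷ L) ∷_) (dom-ēₑ j Γ)

regular-ēₑ : ∀ j Γ → Regular Γ → Regular (ēₑ j Γ)
regular-ēₑ j Γ (u , a) = subst Unique (sym (dom-ēₑ j Γ)) (UniqueP.map⁺ liftV-injective u) , lifted Γ a
  where
  lifted : ∀ Γ → All RegularDecl Γ → All RegularDecl (ēₑ j Γ)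
  lifted [] [] = []
  lifted (_ ∷ Γ) ((w , e) ∷ a) = (ē j w , cong (j ∷_) e) ∷ lifted Γ a

lookup-ēₑ : ∀ j Γ v → lookupE (ēₑ j Γ) (liftV j v) ≡ Maybe.map (ē j) (lookupE Γ v)
lookup-ēₑ j [] v = refl
lookup-ēₑ j (((n , L) , A) ∷ Γ) v with v ≟V (n , L) | liftV j v ≟V (n , j ∷ L)
... | yes refl | yes _ = refl
... | no _ | no _ = lookup-ēₑ j Γ v
... | yes refl | no n = ⊥-elim (n refl)
... | no n | yes e = ⊥-elim (n (liftV-injective e))

lookup-ēₑ-other : ∀ j Γ v → (∀ v₀ → v ≢ liftV j v₀) → lookupE (ēₑ j Γ) v ≡ nothing
lookup-ēₑ-other j Γ v h = lookup-∉ (ēₑ j Γ) λ p → notLifted (subst (_ ∈_) (dom-ēₑ j Γ) p)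
  where
  notLifted : v ∉ map (liftV j) (dom Γ)
  notLifted q with ∈-map⁻ (liftV j) q
  ... | v₀ , _ , e = h v₀ e

fv-lam⁺ : ∀ {y v} M → v ∈ fv M → v ≢ y → v ∈ fv (lam y M)
fv-lam⁺ {y} M p v≢y = ∈-filter⁺ (λ w → ¬? (w ≟V y)) p v≢y

fv-lam⁻ : ∀ {y v} M → v ∈ fv (lam y M) → v ∈ fv M × v ≢ y
fv-lam⁻ {y} M p = ∈-filter⁻ (λ w → ¬? (w ≟V y)) {xs = fv M} p

IsT-deg : ∀ {T} → IsT T → degT T ≡ []
IsT-deg (atom _) = refl
IsT-deg (arr _ _) = refl

record Invariant (M : Term) (Γ : Env) (U : Ty) : Set where
  field
    regular : Regular Γ
    dom⊆fv : ∀ {v} → v ∈ dom Γ → v ∈ fv M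
    fv⊆dom : ∀ {v} → v ∈ fv M → v ∈ dom Γ
    wfU : WfU U
    degU : degT U ≡ deg M
open Invariant public

invariant : ∀ {M Γ U} → M ∶ ⟨ Γ ⊢ U ⟩ → Invariant M Γ U
invariant (ax isT) = record
  { regular = ([] ∷ []) , ((inT isT , IsT-deg isT) ∷ [])
  ; dom⊆fv = λ { (here e) → here e }
  ; fv⊆dom = λ { (here e) → here e }
  ; wfU = inT isT ; degU = IsT-deg isT }
invariant (ωr {M}) = record
  { regular = regular-envω M ; dom⊆fv = envω-dom⁻ M ; fv⊆dom = envω-dom⁺ M ; wfU = ω _ ; degU = refl }
invariant (→I {M} {Γ} isT x∉ d) = record
  { regular = regular-tail (regular I)
  ; dom⊆fv = λ p → fv-lam⁺ M (dom⊆fv I (there p)) (λ e → x∉ (subst (_∈ dom Γ) e p))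
  ; fv⊆dom = λ p → bound (fv-lam⁻ M p)
  ; wfU = inT (arr (proj₁ (regular-head (regular I))) isT)
  ; degU = trans (sym (IsT-deg isT)) (degU I) }
  where
  I = invariant d
  bound : ∀ {v} → v ∈ fv M × v ≢ _ → v ∈ dom Γ
  bound (p , v≢x) with fv⊆dom I p
  ... | here e = ⊥-elim (v≢x e)
  ... | there q = q
invariant (→I' {M} {Γ} {L = L} isT x∉ d) = record
  { regular = regular I
  ; dom⊆fv = λ p → fv-lam⁺ M (dom⊆fv I p) (λ e → x∉ (subst (_∈ dom Γ) e p))
  ; fv⊆dom = λ p → fv⊆dom I (proj₁ (fv-lam⁻ M p))
  ; wfU = inT (arr (ω L) isT)
  ; degU = trans (sym (IsT-deg isT)) (degU I) }
  where I = invariant d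
invariant (→E {M₁} {M₂} {Γ₁} {Γ₂} isT d₁ d₂ _) = record
  { regular = regular-⊓ₑ Γ₁ Γ₂ (regular I₁) (regular I₂)
  ; dom⊆fv = λ p → [ (λ q → ∈-++⁺ˡ (dom⊆fv I₁ q)) , (λ q → ∈-++⁺ʳ (fv M₁) (dom⊆fv I₂ q)) ]′ (dom-⊓ₑ⁻ Γ₁ Γ₂ p)
  ; fv⊆dom = λ p → dom-⊓ₑ⁺ Γ₁ Γ₂ (Sum.map (fv⊆dom I₁) (fv⊆dom I₂) (∈-++⁻ (fv M₁) p))
  ; wfU = inT isT
  ; degU = trans (IsT-deg isT) (degU I₁) }
  where I₁ = invariant d₁
        I₂ = invariant d₂
invariant (⊓I e d₁ d₂) = record
  { regular = regular I ; dom⊆fv = dom⊆fv I ; fv⊆dom = fv⊆dom I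
  ; wfU = _⊓_ (wfU I) (wfU (invariant d₂)) e ; degU = degU I }
  where I = invariant d₁
invariant (er {M} {Γ} j d) = record
  { regular = regular-ēₑ j Γ (regular I)
  ; dom⊆fv = λ p → lifted-dom⊆fv (subst (_ ∈_) (dom-ēₑ j Γ) p)
  ; fv⊆dom = λ p → subst (_ ∈_) (sym (dom-ēₑ j Γ)) (lifted-fv⊆dom (fv-lift⁻ j M p))
  ; wfU = ē j (wfU I)
  ; degU = trans (cong (j ∷_) (degU I)) (sym (deg-lift j M)) }
  where
  I = invariant d
  lifted-dom⊆fv : ∀ {v} → v ∈ map (liftV j) (dom Γ) → v ∈ fv (lift j M)
  lifted-dom⊆fv q with ∈-map⁻ (liftV j) q
  ... | w , r , refl = fv-lift⁺ j M (dom⊆fv I r)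
  lifted-fv⊆dom : ∀ {v} → (Σ Var λ w → w ∈ fv M × v ≡ liftV j w) → v ∈ map (liftV j) (dom Γ)
  lifted-fv⊆dom (w , r , refl) = ∈-map⁺ (liftV j) (fv⊆dom I r)
invariant (⊑r d (s , e)) = record
  { regular = ⊑ₑ-regular e (regular I)
  ; dom⊆fv = λ p → dom⊆fv I (⊑ₑ-dom⁺ e p)
  ; fv⊆dom = λ p → ⊑ₑ-dom⁻ e (fv⊆dom I p)
  ; wfU = proj₂ (⊑-wf s)
  ; degU = trans (sym (⊑-deg s)) (degU I) }
  where I = invariant d

joinable-env : ∀ {M₁ M₂ Γ₁ Γ₂} → M₁ ⋄ M₂ → (∀ {v} → v ∈ dom Γ₁ → v ∈ fv M₁) →
               (∀ {v} → v ∈ dom Γ₂ → v ∈ fv M₂) → Γ₁ ⋄ₑ Γ₂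
joinable-env j h₁ h₂ x L K p q = j x L K (h₁ p) (h₂ q)

var-typing : ∀ v U → WfU U → degT U ≡ proj₂ v → var v ∶ ⟨ (v , U) ∷ [] ⊢ U ⟩
var-typing (n , L) U (inT isT) e with trans (sym e) (IsT-deg isT)
... | refl = ax isT
var-typing (n , L) (ω K) (ω K) refl = ωr
var-typing (n , L) (U ⊓ V) (_⊓_ a b e') e =
  ⊓I e' (⊑r (var-typing (n , L) U a e) (⊑-refl a , ⊑ₑ-point (λ ()) (⊓-elim (_⊓_ a b e'))))
        (⊑r (var-typing (n , L) V b (trans (sym e') e)) (⊑-refl b , ⊑ₑ-point (λ ()) (⊓-elimʳ a b e')))
var-typing (n , .(i ∷ degT U)) (ē i U) (ē i w) refl = er i (var-typing (n , degT U) U w refl)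

abstraction-typing : ∀ {Γ y K P U U' T} → IsT T → WfU U → P ∶ ⟨ Γ ⊢ T ⟩ →
                     lookupE Γ (y , K) ≡ just U' → U ≈ U' → lam (y , K) P ∶ ⟨ rem (y , K) Γ ⊢ U ⇒ T ⟩
abstraction-typing {Γ} {y} {K} {U = U} isT wU dP eU' U≈U' =
  →I isT (rem-∉ (y , K) Γ) (weaken-env dP gP regular-target (inT isT) below)
  where
  gP = regular (invariant dP)
  U'-regular = lookup-regular Γ gP eU'
  regular-target : Regular (((y , K) , U) ∷ rem (y , K) Γ)
  regular-target = regular-cons (regular-rem (y , K) Γ gP) (rem-∉ (y , K) Γ) wU (trans (≈-deg U≈U') (proj₂ U'-regular))
  below : ∀ v → lookupE (((y , K) , U) ∷ rem (y , K) Γ) v ⊑m lookupE Γ v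
  below v with v ≟V (y , K)
  ... | yes refl = subst (just U ⊑m_) (sym eU') (some (⊑-≈ wU (proj₁ U'-regular) U≈U'))
  ... | no v≢y = subst (_⊑m lookupE Γ v) (sym (lookup-rem (y , K) Γ v≢y)) (⊑m-refl gP v)

Sub : Set
Sub = Var → Term

binderName : Sub → ℕ → Index → Term → ℕ
binderName σ y K P = suc (maxName (concatMap (λ w → fv (σ w)) (fv (lam (y , K) P))))

extendSub : Sub → ℕ → Index → ℕ → Sub
extendSub σ y K z w = if does (w ≟V (y , K)) then var (z , K) else σ w

extendSub-here : ∀ σ y K z → extendSub σ y K z (y , K) ≡ var (z , K)
extendSub-here σ y K z rewrite dec-true ((y , K) ≟V (y , K)) refl = refl

extendSub-there : ∀ σ y K z {w} → w ≢ (y , K) → extendSub σ y K z w ≡ σ w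
extendSub-there σ y K z {w} w≢y rewrite dec-false (w ≟V (y , K)) w≢y = refl

maxName-≤ : ∀ {v} xs → v ∈ xs → proj₁ v ≤ maxName xs
maxName-≤ (w ∷ xs) (here refl) = ℕP.m≤m⊔n (proj₁ w) (maxName xs)
maxName-≤ (w ∷ xs) (there p) = ℕP.m≤n⇒m≤o⊔n (proj₁ w) (maxName-≤ xs p)

binderName-fresh : ∀ σ y K P {w v} L → w ∈ fv (lam (y , K) P) → v ∈ fv (σ w) → v ≢ (binderName σ y K P , L)
binderName-fresh σ y K P {w} {v} L p q refl = ℕP.n≮n _ (s≤s (maxName-≤ _ inImage))
  where
  inImage : v ∈ concatMap (λ w → fv (σ w)) (fv (lam (y , K) P))
  inImage = ∈-concatMap⁺ (λ w → fv (σ w)) {xs = fv (lam (y , K) P)} (Any.map (λ { refl → q }) p)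

deg-ssubst : ∀ σ M → (∀ {w} → w ∈ fv M → deg (σ w) ≡ proj₂ w) → deg (ssubst σ M) ≡ deg M
deg-ssubst σ (var w) h = h (here refl)
deg-ssubst σ (app M N) h = deg-ssubst σ M (λ p → h (∈-++⁺ˡ p))
deg-ssubst σ (lam (y , K) P) h = deg-ssubst (extendSub σ y K (binderName σ y K P)) P h'
  where
  h' : ∀ {w} → w ∈ fv P → deg (extendSub σ y K (binderName σ y K P) w) ≡ proj₂ w
  h' {w} p with w ≟V (y , K)
  ... | yes refl = refl
  ... | no w≢y = h (fv-lam⁺ P p w≢y)

fv-ssubst⁻ : ∀ σ M {v} → v ∈ fv (ssubst σ M) → Σ Var λ w → w ∈ fv M × v ∈ fv (σ w)
fv-ssubst⁻ σ (var w) p = w , here refl , p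
fv-ssubst⁻ σ (app M N) p with ∈-++⁻ (fv (ssubst σ M)) p
... | inj₁ q with fv-ssubst⁻ σ M q
... | w , r , s = w , ∈-++⁺ˡ r , s
fv-ssubst⁻ σ (app M N) p | inj₂ q with fv-ssubst⁻ σ N q
... | w , r , s = w , ∈-++⁺ʳ (fv M) r , s
fv-ssubst⁻ σ (lam (y , K) P) {v} p with fv-lam⁻ (ssubst (extendSub σ y K (binderName σ y K P)) P) p
... | q , v≢z with fv-ssubst⁻ (extendSub σ y K (binderName σ y K P)) P q
... | w , r , s with w ≟V (y , K)
... | yes refl = ⊥-elim (v≢z (isBinder s))
  where isBinder : v ∈ fv (var (binderName σ y K P , K)) → v ≡ (binderName σ y K P , K)
        isBinder (here e) = e
... | no w≢y = w , fv-lam⁺ P r w≢y , s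

fv-ssubst⁺ : ∀ σ M {w v} → w ∈ fv M → v ∈ fv (σ w) → v ∈ fv (ssubst σ M)
fv-ssubst⁺ σ (var w) (here refl) q = q
fv-ssubst⁺ σ (app M N) p q with ∈-++⁻ (fv M) p
... | inj₁ r = ∈-++⁺ˡ (fv-ssubst⁺ σ M r q)
... | inj₂ r = ∈-++⁺ʳ (fv (ssubst σ M)) (fv-ssubst⁺ σ N r q)
fv-ssubst⁺ σ (lam (y , K) P) {w} {v} p q with fv-lam⁻ P p
... | r , w≢y = fv-lam⁺ (ssubst σ' P) (fv-ssubst⁺ σ' P r (subst (λ t → v ∈ fv t) (sym (extendSub-there σ y K _ w≢y)) q))
                  (binderName-fresh σ y K P K p q)
  where σ' = extendSub σ y K (binderName σ y K P)

fv-var : ∀ {v w} → v ∈ fv (var w) → v ≡ w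
fv-var (here e) = e

IndexPreserving : (Var → Var) → Set
IndexPreserving ρ = ∀ w → proj₂ (ρ w) ≡ proj₂ w

extendRen : (Var → Var) → ℕ → Index → ℕ → Var → Var
extendRen ρ y K z w = if does (w ≟V (y , K)) then (z , K) else ρ w

extendRen-here : ∀ ρ y K z → extendRen ρ y K z (y , K) ≡ (z , K)
extendRen-here ρ y K z rewrite dec-true ((y , K) ≟V (y , K)) refl = refl

extendRen-there : ∀ ρ y K z {w} → w ≢ (y , K) → extendRen ρ y K z w ≡ ρ w
extendRen-there ρ y K z {w} w≢y rewrite dec-false (w ≟V (y , K)) w≢y = refl

extendRen-index : ∀ ρ y K z → IndexPreserving ρ → IndexPreserving (extendRen ρ y K z)
extendRen-index ρ y K z ρ-idx w with w ≟V (y , K)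
... | yes refl = refl
... | no _ = ρ-idx w

renamed-fresh : ∀ (σ : Sub) (ρ : Var → Var) y K P {w} L → w ∈ fv (lam (y , K) P) → σ w ≡ var (ρ w) →
                ρ w ≢ (binderName σ y K P , L)
renamed-fresh σ ρ y K P {w} L p e = binderName-fresh σ y K P L p (subst (λ t → ρ w ∈ fv t) (sym e) (here refl))

extend-agree : ∀ (σ : Sub) (ρ : Var → Var) y K z P (S : Var → Set) →
  (∀ {w} → w ∈ fv (lam (y , K) P) → S w → σ w ≡ var (ρ w)) →
  ∀ {w} → w ∈ fv P → S w → extendSub σ y K z w ≡ var (extendRen ρ y K z w)
extend-agree σ ρ y K z P S agree {w} p s with w ≟V (y , K)
... | yes refl = refl
... | no w≢y = agree (fv-lam⁺ P p w≢y) s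

extendRen-injective : ∀ (σ : Sub) (ρ : Var → Var) y K P (S : Var → Set) →
  (∀ {w} → w ∈ fv (lam (y , K) P) → S w → σ w ≡ var (ρ w)) →
  (∀ {w w'} → w ∈ fv (lam (y , K) P) → w' ∈ fv (lam (y , K) P) → S w → S w' → ρ w ≡ ρ w' → w ≡ w') →
  ∀ {w w'} → w ∈ fv P → w' ∈ fv P → S w → S w' →
  extendRen ρ y K (binderName σ y K P) w ≡ extendRen ρ y K (binderName σ y K P) w' → w ≡ w'
extendRen-injective σ ρ y K P S agree inj {w} {w'} p p' s s' e with w ≟V (y , K) | w' ≟V (y , K)
... | yes refl | yes refl = refl
... | yes refl | no w'≢y = ⊥-elim (renamed-fresh σ ρ y K P K q' (agree q' s') (sym e))
  where q' = fv-lam⁺ P p' w'≢y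
... | no w≢y | yes refl = ⊥-elim (renamed-fresh σ ρ y K P K q (agree q s) e)
  where q = fv-lam⁺ P p w≢y
... | no w≢y | no w'≢y = inj (fv-lam⁺ P p w≢y) (fv-lam⁺ P p' w'≢y) s s' e

renamed-dom : ∀ {M Γ U} (σ : Sub) (ρ : Var → Var) → ssubst σ M ∶ ⟨ Γ ⊢ U ⟩ →
  (∀ {w} → w ∈ fv M → σ w ≡ var (ρ w)) → ∀ {v} → v ∈ dom Γ → Σ Var λ w → w ∈ fv M × ρ w ≡ v
renamed-dom {M} σ ρ d agree q with fv-ssubst⁻ σ M (dom⊆fv (invariant d) q)
... | w , p , r = w , p , sym (fv-var (subst (λ s → _ ∈ fv s) (agree p) r))

-- Rule (e) types only lifted terms M^{+j}; if a
-- substitution instance σ(M) is lifted then so is M (when σ maps only variables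
-- with index j∷K to lifted terms), and the substitution commutes with lifting.

data Lifted (j : ℕ) : Term → Set where
  var : ∀ n K → Lifted j (var (n , j ∷ K))
  app : ∀ {M N} → Lifted j M → Lifted j N → Lifted j (app M N)
  lam : ∀ n K {P} → Lifted j P → Lifted j (lam (n , j ∷ K) P)

HeadIndex : ℕ → Var → Set
HeadIndex j w = Σ Index λ K → proj₂ w ≡ j ∷ K

dropHead : Index → Index
dropHead [] = []
dropHead (_ ∷ K) = K

unliftV : Var → Var
unliftV (n , L) = (n , dropHead L)

unlift : Term → Term
unlift (var v) = var (unliftV v)
unlift (app M N) = app (unlift M) (unlift N)
unlift (lam v P) = lam (unliftV v) (unlift P)

unlift-lift : ∀ j M → unlift (lift j M) ≡ M
unlift-lift j (var (n , L)) = refl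
unlift-lift j (app M N) = cong₂ app (unlift-lift j M) (unlift-lift j N)
unlift-lift j (lam (n , L) P) = cong (lam (n , L)) (unlift-lift j P)

lift-unlift : ∀ {j M} → Lifted j M → lift j (unlift M) ≡ M
lift-unlift (var n K) = refl
lift-unlift (app p q) = cong₂ app (lift-unlift p) (lift-unlift q)
lift-unlift (lam n K p) = cong (lam (n , _ ∷ K)) (lift-unlift p)

lift-Lifted : ∀ j M → Lifted j (lift j M)
lift-Lifted j (var (n , L)) = var n L
lift-Lifted j (app M N) = app (lift-Lifted j M) (lift-Lifted j N)
lift-Lifted j (lam (n , L) P) = lam n L (lift-Lifted j P)

Lifted-deg : ∀ {j M} → Lifted j M → HeadIndex j (0 , deg M)
Lifted-deg (var n K) = K , refl
Lifted-deg (app p _) = Lifted-deg p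
Lifted-deg (lam n K p) = Lifted-deg p

Lifted-var : ∀ {j v} → Lifted j (var v) → HeadIndex j v
Lifted-var (var n K) = K , refl

Lifted-ssubst-sub : ∀ {j} σ M → Lifted j (ssubst σ M) → ∀ {w} → w ∈ fv M → Lifted j (σ w)
Lifted-ssubst-sub σ (var w) l (here refl) = l
Lifted-ssubst-sub σ (app M N) (app l l') p with ∈-++⁻ (fv M) p
... | inj₁ q = Lifted-ssubst-sub σ M l q
... | inj₂ q = Lifted-ssubst-sub σ N l' q
Lifted-ssubst-sub σ (lam (y , K) P) (lam _ _ l) p with fv-lam⁻ P p
... | q , w≢y =
  subst (Lifted _) (extendSub-there σ y K _ w≢y) (Lifted-ssubst-sub (extendSub σ y K (binderName σ y K P)) P l q)

Lifted-ssubst-term : ∀ {j} σ M → Lifted j (ssubst σ M) → (∀ {w} → w ∈ fv M → Lifted j (σ w) → HeadIndex j w) →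
                     Lifted j M
Lifted-ssubst-term σ (var (n , L)) l h with h (here refl) l
... | K , refl = var n K
Lifted-ssubst-term σ (app M N) (app l l') h =
  app (Lifted-ssubst-term σ M l (λ p → h (∈-++⁺ˡ p))) (Lifted-ssubst-term σ N l' (λ p → h (∈-++⁺ʳ (fv M) p)))
Lifted-ssubst-term {j} σ (lam (y , .(j ∷ K)) P) (lam _ K l) h = lam y K (Lifted-ssubst-term σ' P l h')
  where
  σ' = extendSub σ y (j ∷ K) (binderName σ y (j ∷ K) P)
  h' : ∀ {w} → w ∈ fv P → Lifted j (σ' w) → HeadIndex j w
  h' {w} p l' with w ≟V (y , j ∷ K)
  ... | yes refl = K , refl
  ... | no w≢y = h (fv-lam⁺ P p w≢y) l'

lift-ssubst : ∀ j (σ₀ : Sub) M₀ (σ : Sub) → (∀ {w} → w ∈ fv M₀ → σ (liftV j w) ≡ lift j (σ₀ w)) →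
              ssubst σ (lift j M₀) ≡ lift j (ssubst σ₀ M₀)
lift-ssubst j σ₀ (var (n , L)) σ h = h (here refl)
lift-ssubst j σ₀ (app M N) σ h =
  cong₂ app (lift-ssubst j σ₀ M σ (λ p → h (∈-++⁺ˡ p))) (lift-ssubst j σ₀ N σ (λ p → h (∈-++⁺ʳ (fv M) p)))
lift-ssubst j σ₀ (lam (y , K) P) σ h = sameBinder (binderName σ y (j ∷ K) (lift j P)) binderName-lift
  where
  z₀ = binderName σ₀ y K P
  names-lift : ∀ xs → (∀ {w} → w ∈ xs → σ (liftV j w) ≡ lift j (σ₀ w)) →
    concatMap (λ w → fv (σ w)) (map (liftV j) xs) ≡ map (liftV j) (concatMap (λ w → fv (σ₀ w)) xs)
  names-lift [] h' = refl
  names-lift (w ∷ xs) h' rewrite h' (here refl) | fv-lift j (σ₀ w) | names-lift xs (λ p → h' (there p)) =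
    sym (ListP.map-++ (liftV j) (fv (σ₀ w)) (concatMap (λ w → fv (σ₀ w)) xs))
  maxName-lift : ∀ xs → maxName (map (liftV j) xs) ≡ maxName xs
  maxName-lift [] = refl
  maxName-lift ((n , L) ∷ xs) = cong (n ⊔_) (maxName-lift xs)
  binderName-lift : binderName σ y (j ∷ K) (lift j P) ≡ z₀
  binderName-lift = cong suc (trans
    (cong maxName (trans (cong (concatMap (λ w → fv (σ w))) (fv-lift j (lam (y , K) P)))
                         (names-lift (fv (lam (y , K) P)) h)))
    (maxName-lift (concatMap (λ w → fv (σ₀ w)) (fv (lam (y , K) P)))))
  σ₀' = extendSub σ₀ y K z₀
  σ' = extendSub σ y (j ∷ K) z₀
  h' : ∀ {w} → w ∈ fv P → σ' (liftV j w) ≡ lift j (σ₀' w)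
  h' {w} p with w ≟V (y , K)
  ... | yes refl rewrite extendSub-here σ y (j ∷ K) z₀ = refl
  ... | no w≢y rewrite extendSub-there σ y (j ∷ K) z₀ {liftV j w} (λ e → w≢y (liftV-injective e)) =
    h (fv-lam⁺ P p w≢y)
  sameBinder : ∀ z → z ≡ z₀ →
    Term.lam (z , j ∷ K) (ssubst (extendSub σ y (j ∷ K) z) (lift j P)) ≡ Term.lam (z₀ , j ∷ K) (lift j (ssubst σ₀' P))
  sameBinder .z₀ refl = cong (Term.lam (z₀ , j ∷ K)) (lift-ssubst j σ₀' P σ' h')

record LiftInversion (j : ℕ) (σ : Sub) (M R : Term) : Set where
  field
    M₀ : Term
    M≡ : M ≡ lift j M₀
    R≡ : R ≡ ssubst (λ w → unlift (σ (liftV j w))) M₀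

lift-inversion : ∀ j σ M R → ssubst σ M ≡ lift j R → (∀ {w} → w ∈ fv M → Lifted j (σ w) → HeadIndex j w) →
                 LiftInversion j σ M R
lift-inversion j σ M R e h = record { M₀ = unlift M ; M≡ = sym M≡ ; R≡ = R≡ }
  where
  σ-lifted : Lifted j (ssubst σ M)
  σ-lifted = subst (Lifted j) (sym e) (lift-Lifted j R)
  M≡ : lift j (unlift M) ≡ M
  M≡ = lift-unlift (Lifted-ssubst-term σ M σ-lifted h)
  σ≡ : ∀ {w} → w ∈ fv (unlift M) → σ (liftV j w) ≡ lift j (unlift (σ (liftV j w)))
  σ≡ p = sym (lift-unlift (Lifted-ssubst-sub σ M σ-lifted (subst (λ t → _ ∈ fv t) M≡ (fv-lift⁺ j (unlift M) p))))
  R≡ : R ≡ ssubst (λ w → unlift (σ (liftV j w))) (unlift M)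
  R≡ = begin
    R                                                          ≡⟨ sym (unlift-lift j R) ⟩
    unlift (lift j R)                                          ≡⟨ cong unlift (sym e) ⟩
    unlift (ssubst σ M)                                        ≡⟨ cong (λ t → unlift (ssubst σ t)) (sym M≡) ⟩
    unlift (ssubst σ (lift j (unlift M)))                      ≡⟨ cong unlift (lift-ssubst j _ (unlift M) σ σ≡) ⟩
    unlift (lift j (ssubst (λ w → unlift (σ (liftV j w))) (unlift M))) ≡⟨ unlift-lift j _ ⟩
    ssubst (λ w → unlift (σ (liftV j w))) (unlift M)           ∎
    where open ≡-Reasoning

IsTerm-unlift : ∀ j M → IsTerm (lift j M) → IsTerm M
IsTerm-unlift j (var (n , L)) _ = var _
IsTerm-unlift j (app M N) (app tM tN (L₃ , e) joinable) =
  app (IsTerm-unlift j M tM) (IsTerm-unlift j N tN)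
    (L₃ , ListP.∷-injectiveʳ (trans (sym (deg-lift j N)) (trans e (cong (_++ L₃) (deg-lift j M)))))
    (λ x L K p q → ListP.∷-injectiveʳ (joinable x (j ∷ L) (j ∷ K) (fv-lift⁺ j M p) (fv-lift⁺ j N q)))
IsTerm-unlift j (lam (n , L) P) (lam tP (L₃ , e)) =
  lam (IsTerm-unlift j P tP) (L₃ , ListP.∷-injectiveʳ (trans e (cong (_++ L₃) (deg-lift j P))))

renaming-lift : ∀ j (ρ : Var → Var) → IndexPreserving ρ → ∀ w → ρ (liftV j w) ≡ liftV j (unliftV (ρ (liftV j w)))
renaming-lift j ρ ρ-idx w with ρ (liftV j w) | ρ-idx (liftV j w)
... | (a , .(j ∷ proj₂ w)) | refl = refl

record RenamingOn (S : Var → Set) (σ : Sub) (ρ : Var → Var) (M : Term) : Set where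
  field
    agree : ∀ {w} → w ∈ fv M → S w → σ w ≡ var (ρ w)
    index : IndexPreserving ρ
    injective : ∀ {w w'} → w ∈ fv M → w' ∈ fv M → S w → S w' → ρ w ≡ ρ w' → w ≡ w'
open RenamingOn public

Renaming : Sub → (Var → Var) → Term → Set
Renaming = RenamingOn (λ _ → ⊤)

RenamingOn-mono : ∀ {S S' σ ρ M} → (∀ {w} → w ∈ fv M → S' w → S w) → RenamingOn S σ ρ M → RenamingOn S' σ ρ M
RenamingOn-mono f R = record
  { agree = λ p s → agree R p (f p s) ; index = index R
  ; injective = λ p p' s s' → injective R p p' (f p s) (f p' s') }

RenamingOn-appˡ : ∀ {S σ ρ M₁ M₂} → RenamingOn S σ ρ (app M₁ M₂) → RenamingOn S σ ρ M₁
RenamingOn-appˡ R = record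
  { agree = λ p → agree R (∈-++⁺ˡ p) ; index = index R
  ; injective = λ p p' → injective R (∈-++⁺ˡ p) (∈-++⁺ˡ p') }

RenamingOn-appʳ : ∀ {S σ ρ M₁ M₂} → RenamingOn S σ ρ (app M₁ M₂) → RenamingOn S σ ρ M₂
RenamingOn-appʳ {M₁ = M₁} R = record
  { agree = λ p → agree R (∈-++⁺ʳ (fv M₁) p) ; index = index R
  ; injective = λ p p' → injective R (∈-++⁺ʳ (fv M₁) p) (∈-++⁺ʳ (fv M₁) p') }

RenamingOn-under : ∀ {S σ ρ y K P} → RenamingOn S σ ρ (lam (y , K) P) →
  RenamingOn S (extendSub σ y K (binderName σ y K P)) (extendRen ρ y K (binderName σ y K P)) P
RenamingOn-under {S} {σ} {ρ} {y} {K} {P} R = record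
  { agree = extend-agree σ ρ y K (binderName σ y K P) P S (agree R)
  ; index = extendRen-index ρ y K _ (index R)
  ; injective = extendRen-injective σ ρ y K P S (agree R) (injective R) }

unliftSub : ℕ → Sub → Sub
unliftSub j σ w = unlift (σ (liftV j w))

unliftRen : ℕ → (Var → Var) → Var → Var
unliftRen j ρ w = unliftV (ρ (liftV j w))

RenamingOn-unlift : ∀ {S σ ρ M} j M₀ → M ≡ lift j M₀ → RenamingOn S σ ρ M →
  RenamingOn (λ w → S (liftV j w)) (unliftSub j σ) (unliftRen j ρ) M₀
RenamingOn-unlift {ρ = ρ} j M₀ refl R = record
  { agree = λ p s → cong unlift (agree R (fv-lift⁺ j M₀ p) s)
  ; index = λ w → cong dropHead (index R (liftV j w))
  ; injective = λ {w} {w'} p p' s s' e → liftV-injective (injective R (fv-lift⁺ j M₀ p) (fv-lift⁺ j M₀ p') s s'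
      (trans (renaming-lift j ρ (index R) w) (trans (cong (liftV j) e) (sym (renaming-lift j ρ (index R) w'))))) }

renaming-head : ∀ {S σ ρ M} j → RenamingOn S σ ρ M → ∀ {w} → w ∈ fv M → S w → Lifted j (σ w) → HeadIndex j w
renaming-head j R {w} p s l with Lifted-var (subst (Lifted j) (agree R p s) l)
... | K , e = K , trans (sym (index R w)) e

var-injective : ∀ {a b} → Term.var a ≡ var b → a ≡ b
var-injective refl = refl

record RenSplit (Γ : Env) (U : Ty) (ρ : Var → Var) (M : Term) : Set where
  constructor renSplit
  field
    Γ₁ : Env
    typing : M ∶ ⟨ Γ₁ ⊢ U ⟩
    shared : ∀ {w} → w ∈ fv M → lookupE Γ (ρ w) ≈m lookupE Γ₁ w

-- For w outside fv M both sides are empty, provided no free variable of M is renamed to ρ w.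
RenSplit-extend : ∀ {Γ U σ ρ M} → ssubst σ M ∶ ⟨ Γ ⊢ U ⟩ → (∀ {w} → w ∈ fv M → σ w ≡ var (ρ w)) →
  (R : RenSplit Γ U ρ M) → ∀ w → (∀ {w'} → w' ∈ fv M → ρ w' ≡ ρ w → w' ≡ w) →
  lookupE Γ (ρ w) ≈m lookupE (RenSplit.Γ₁ R) w
RenSplit-extend {Γ} {σ = σ} {ρ} {M} d agreeM (renSplit Γ₁ dM shared) w only with w ∈?V fv M
... | yes p = shared p
... | no w∉ = subst₂ _≈m_ (sym (lookup-∉ Γ ρw∉)) (sym (lookup-∉ Γ₁ (λ q → w∉ (dom⊆fv (invariant dM) q)))) none
  where
  ρw∉ : ρ w ∉ dom Γ
  ρw∉ q with renamed-dom {M} σ ρ d agreeM q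
  ... | w' , p' , e = w∉ (subst (_∈ fv M) (only p' e) p')

ren-var : ∀ {x T ρ w} → IsT T → IndexPreserving ρ → ρ w ≡ (x , []) → RenSplit (((x , []) , T) ∷ []) T ρ (var w)
ren-var {x} {T} {ρ} {w} isT ρ-idx ρw = renSplit ((w , T) ∷ []) typing shared
  where
  typing : var w ∶ ⟨ (w , T) ∷ [] ⊢ T ⟩
  typing = var-typing w T (inT isT) (trans (IsT-deg isT) (sym (trans (sym (ρ-idx w)) (cong proj₂ ρw))))
  shared : ∀ {w'} → w' ∈ fv (var w) → lookupE (((x , []) , T) ∷ []) (ρ w') ≈m lookupE ((w , T) ∷ []) w'
  shared (here refl) rewrite ρw | lookup-here (x , []) T [] | lookup-here w T [] = some ≈-refl

ren-ω : ∀ {ρ} σ M → Renaming σ ρ M → RenSplit (envω (ssubst σ M)) (ω (deg (ssubst σ M))) ρ M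
ren-ω {ρ} σ M R = renSplit (envω M) typing shared
  where
  typing : M ∶ ⟨ envω M ⊢ ω (deg (ssubst σ M)) ⟩
  typing = subst (λ L → M ∶ ⟨ envω M ⊢ ω L ⟩)
             (sym (deg-ssubst σ M (λ p → trans (cong deg (agree R p tt)) (index R _)))) ωr
  shared : ∀ {w} → w ∈ fv M → lookupE (envω (ssubst σ M)) (ρ w) ≈m lookupE (envω M) w
  shared {w} p = ≈m-≡ (trans (lookup-envω⁺ (ssubst σ M) (fv-ssubst⁺ σ M p (subst (λ s → ρ w ∈ fv s) (sym (agree R p tt)) (here refl))))
                      (trans (cong (λ L → just (ω L)) (index R w)) (sym (lookup-envω⁺ M p))))

ren-app : ∀ {Γa Γb U T σ ρ M₁ M₂} → IsT T → M₁ ⋄ M₂ → Renaming σ ρ (app M₁ M₂) →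
  ssubst σ M₁ ∶ ⟨ Γa ⊢ U ⇒ T ⟩ → ssubst σ M₂ ∶ ⟨ Γb ⊢ U ⟩ →
  RenSplit Γa (U ⇒ T) ρ M₁ → RenSplit Γb U ρ M₂ → RenSplit (Γa ⊓ₑ Γb) T ρ (app M₁ M₂)
ren-app {Γa} {Γb} {ρ = ρ} {M₁} {M₂} isT joinable R d₁ d₂ R₁@(renSplit Γ₁a dM₁ _) R₂@(renSplit Γ₁b dM₂ _) =
  renSplit (Γ₁a ⊓ₑ Γ₁b) typing shared
  where
  typing = →E isT dM₁ dM₂ (joinable-env {M₁} {M₂} joinable (dom⊆fv (invariant dM₁)) (dom⊆fv (invariant dM₂)))
  shared : ∀ {w} → w ∈ fv (app M₁ M₂) → lookupE (Γa ⊓ₑ Γb) (ρ w) ≈m lookupE (Γ₁a ⊓ₑ Γ₁b) w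
  shared {w} p = subst₂ _≈m_ (sym (lookup-⊓ₑ Γa Γb (ρ w))) (sym (lookup-⊓ₑ Γ₁a Γ₁b w))
    (⊓m-cong (RenSplit-extend d₁ (λ q → agree R (∈-++⁺ˡ q) tt) R₁ w (λ q e → injective R (∈-++⁺ˡ q) p tt tt e))
             (RenSplit-extend d₂ (λ q → agree R (∈-++⁺ʳ (fv M₁) q) tt) R₂ w
                (λ q e → injective R (∈-++⁺ʳ (fv M₁) q) p tt tt e)))

meet-typings : ∀ {M Γa Γb U₁ U₂} → degT U₁ ≡ degT U₂ → M ∶ ⟨ Γa ⊢ U₁ ⟩ → M ∶ ⟨ Γb ⊢ U₂ ⟩ →
               M ∶ ⟨ Γa ⊓ₑ Γb ⊢ U₁ ⊓ U₂ ⟩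
meet-typings {Γa = Γa} {Γb} e da db =
  ⊓I e (weaken-env da (regular Ia) g (wfU Ia) (meet-⊑ˡ Γa Γb (regular Ia) (regular Ib) ba))
       (weaken-env db (regular Ib) g (wfU Ib) (meet-⊑ʳ Γa Γb (regular Ia) (regular Ib) ab))
  where
  Ia = invariant da
  Ib = invariant db
  ab : ∀ {v} → v ∈ dom Γa → v ∈ dom Γb
  ab q = fv⊆dom Ib (dom⊆fv Ia q)
  ba : ∀ {v} → v ∈ dom Γb → v ∈ dom Γa
  ba q = fv⊆dom Ia (dom⊆fv Ib q)
  g = regular-⊓ₑ Γa Γb (regular Ia) (regular Ib)

ren-⊓ : ∀ {Γ U₁ U₂ ρ M} → degT U₁ ≡ degT U₂ → RenSplit Γ U₁ ρ M → RenSplit Γ U₂ ρ M → RenSplit Γ (U₁ ⊓ U₂) ρ M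
ren-⊓ {Γ} {ρ = ρ} {M} e (renSplit Γ₁a da shared-a) (renSplit Γ₁b db shared-b) =
  renSplit (Γ₁a ⊓ₑ Γ₁b) (meet-typings e da db) shared
  where
  shared : ∀ {w} → w ∈ fv M → lookupE Γ (ρ w) ≈m lookupE (Γ₁a ⊓ₑ Γ₁b) w
  shared {w} p = subst (λ m → lookupE Γ (ρ w) ≈m m) (sym (lookup-⊓ₑ Γ₁a Γ₁b w))
    (≈m-trans (≈m-sym ⊓m-idem) (⊓m-cong (shared-a p) (shared-b p)))

ren-lift : ∀ {Γ₀ U₀ ρ M} j M₀ → M ≡ lift j M₀ → IndexPreserving ρ →
  RenSplit Γ₀ U₀ (unliftRen j ρ) M₀ → RenSplit (ēₑ j Γ₀) (ē j U₀) ρ M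
ren-lift {Γ₀} {ρ = ρ} j M₀ refl ρ-idx (renSplit Γ₁ d₀ shared₀) = renSplit (ēₑ j Γ₁) (er j d₀) shared
  where
  shared : ∀ {w} → w ∈ fv (lift j M₀) → lookupE (ēₑ j Γ₀) (ρ w) ≈m lookupE (ēₑ j Γ₁) w
  shared p with fv-lift⁻ j M₀ p
  ... | w₀ , q , refl rewrite renaming-lift j ρ ρ-idx w₀ | lookup-ēₑ j Γ₀ (unliftRen j ρ w₀) | lookup-ēₑ j Γ₁ w₀ =
    ≈m-mapē (shared₀ q)

module Binder (σ : Sub) (ρ : Var → Var) (y : ℕ) (K : Index) (P : Term) where
  z : ℕ
  z = binderName σ y K P

  σ' : Sub
  σ' = extendSub σ y K z

  ρ' : Var → Var
  ρ' = extendRen ρ y K z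

  binder-used : ∀ {Γ U T} → ssubst σ' P ∶ ⟨ ((z , K) , U) ∷ Γ ⊢ T ⟩ → (y , K) ∈ fv P
  binder-used d with fv-ssubst⁻ σ' P (dom⊆fv (invariant d) (here refl))
  ... | w , wP , zw with w ≟V (y , K)
  ... | yes refl = wP
  ... | no w≢y = ⊥-elim (binderName-fresh σ y K P K (fv-lam⁺ P wP w≢y) zw refl)

  binder-unused : ∀ {Γ T} → (z , K) ∉ dom Γ → ssubst σ' P ∶ ⟨ Γ ⊢ T ⟩ → (y , K) ∉ fv P
  binder-unused z∉ d yP = z∉ (fv⊆dom (invariant d) (fv-ssubst⁺ σ' P yP zInσ'y))
    where
    zInσ'y : (z , K) ∈ fv (σ' (y , K))
    zInσ'y = subst (λ s → (z , K) ∈ fv s) (sym (extendSub-here σ y K z)) (here refl)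

  lookup-binder : ∀ Γ U → lookupE (((z , K) , U) ∷ Γ) (ρ' (y , K)) ≡ just U
  lookup-binder Γ U = trans (cong (lookupE (((z , K) , U) ∷ Γ)) (extendRen-here ρ y K z)) (lookup-here (z , K) U Γ)

  lookup-other : ∀ Γ U {w} → w ∈ fv (lam (y , K) P) → σ w ≡ var (ρ w) →
                 lookupE (((z , K) , U) ∷ Γ) (ρ' w) ≡ lookupE Γ (ρ w)
  lookup-other Γ U p e = trans (cong (lookupE (((z , K) , U) ∷ Γ)) (extendRen-there ρ y K z (proj₂ (fv-lam⁻ P p))))
                                   (lookup-there U Γ (renamed-fresh σ ρ y K P K p e))

  ren-abs : ∀ {Γ U T} → IsT T → ssubst σ' P ∶ ⟨ ((z , K) , U) ∷ Γ ⊢ T ⟩ → Renaming σ ρ (lam (y , K) P) →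
            RenSplit (((z , K) , U) ∷ Γ) T ρ' P → RenSplit Γ (U ⇒ T) ρ (lam (y , K) P)
  ren-abs {Γ} {U} {T} isT d R (renSplit Γ₁ dP shared') = renSplit (rem (y , K) Γ₁) typing shared
    where
    U-declared : Σ Ty λ U' → lookupE Γ₁ (y , K) ≡ just U' × U ≈ U'
    U-declared = OptRel-just (subst (_≈m _) (lookup-binder Γ U) (shared' (binder-used d)))
    typing : lam (y , K) P ∶ ⟨ rem (y , K) Γ₁ ⊢ U ⇒ T ⟩
    typing = abstraction-typing isT (proj₁ (regular-head (regular (invariant d)))) dP
               (proj₁ (proj₂ U-declared)) (proj₂ (proj₂ U-declared))
    shared : ∀ {w} → w ∈ fv (lam (y , K) P) → lookupE Γ (ρ w) ≈m lookupE (rem (y , K) Γ₁) w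
    shared {w} p = subst₂ _≈m_ (lookup-other Γ U p (agree R p tt)) (sym (lookup-rem (y , K) Γ₁ (proj₂ (fv-lam⁻ P p))))
                     (shared' (proj₁ (fv-lam⁻ P p)))

  ren-abs' : ∀ {Γ T} → IsT T → (z , K) ∉ dom Γ → ssubst σ' P ∶ ⟨ Γ ⊢ T ⟩ →
             RenSplit Γ T ρ' P → RenSplit Γ (ω K ⇒ T) ρ (lam (y , K) P)
  ren-abs' {Γ} isT z∉ d (renSplit Γ₁ dP shared') = renSplit Γ₁ typing shared
    where
    typing = →I' isT (λ q → binder-unused z∉ d (dom⊆fv (invariant dP) q)) dP
    shared : ∀ {w} → w ∈ fv (lam (y , K) P) → lookupE Γ (ρ w) ≈m lookupE Γ₁ w
    shared {w} p = subst (λ m → lookupE Γ m ≈m lookupE Γ₁ w) (extendRen-there ρ y K z (proj₂ (fv-lam⁻ P p)))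
                     (shared' (proj₁ (fv-lam⁻ P p)))

⊑ₑ-below : ∀ {Γ' Γ D A} v → Γ' ⊑ₑ Γ → Regular Γ → lookupE Γ v ≡ just D → D ⊑ A →
           Σ Ty λ C → lookupE Γ' v ≡ just C × C ⊑ A
⊑ₑ-below {Γ'} v e g eD D⊑A with OptRel-just⁻ (subst (lookupE Γ' v ⊑m_) eD (⊑ₑ-lookup e g v))
... | C , eC , C⊑D = C , eC , ⊑-trans C⊑D D⊑A

retype-typing : ∀ {M Δ U U'} (g : Var → Ty → Ty) → M ∶ ⟨ Δ ⊢ U ⟩ → U ⊑ U' →
                (∀ {v A} → lookupE Δ v ≡ just A → g v A ⊑ A) → M ∶ ⟨ mapE g Δ ⊢ U' ⟩
retype-typing {Δ = Δ} g d s h = ⊑r d (s , pointwise⇒⊑ₑ gΔ (regular-mapE g Δ gΔ regularAt) below)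
  where
  gΔ = regular (invariant d)
  regularAt : ∀ {v A} → (v , A) ∈ Δ → RegularDecl (v , g v A)
  regularAt p with h (lookup-complete Δ (proj₁ gΔ) p)
  ... | gA⊑A = proj₁ (⊑-wf gA⊑A) , trans (⊑-deg gA⊑A) (proj₂ (All.lookup (proj₂ gΔ) p))
  below : ∀ v → lookupE (mapE g Δ) v ⊑m lookupE Δ v
  below v rewrite lookup-mapE g Δ v with lookupE Δ v in q
  ... | nothing = none
  ... | just A = some (h q)

retypeBy : Env → (Var → Var) → Var → Ty → Ty
retypeBy Γ' ρ w A = fromMaybe A (lookupE Γ' (ρ w))

retypeBy-just : ∀ Γ' ρ {v C} A → lookupE Γ' (ρ v) ≡ just C → retypeBy Γ' ρ v A ≡ C
retypeBy-just Γ' ρ A e rewrite e = refl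

ren-⊑ : ∀ {t Γ Γ' U U' ρ M} → t ∶ ⟨ Γ ⊢ U ⟩ → U ⊑ U' → Γ' ⊑ₑ Γ →
        RenSplit Γ U ρ M → RenSplit Γ' U' ρ M
ren-⊑ {Γ = Γ} {Γ'} {ρ = ρ} {M} d s e (renSplit Γ₁ dM shared) =
  renSplit (mapE (retypeBy Γ' ρ) Γ₁) (retype-typing (retypeBy Γ' ρ) dM s below) shared'
  where
  gΓ = regular (invariant d)
  gΓ₁ = regular (invariant dM)
  weakened : ∀ {v A} → lookupE Γ₁ v ≡ just A → Σ Ty λ C → lookupE Γ' (ρ v) ≡ just C × C ⊑ A
  weakened {v} {A} q with OptRel-just⁻ (subst (lookupE Γ (ρ v) ≈m_) q (shared (dom⊆fv (invariant dM) (lookup-dom Γ₁ q))))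
  ... | D , eD , D≈A = ⊑ₑ-below (ρ v) e gΓ eD (⊑-≈ (proj₁ (lookup-regular Γ gΓ eD)) (proj₁ (lookup-regular Γ₁ gΓ₁ q)) D≈A)
  below : ∀ {v A} → lookupE Γ₁ v ≡ just A → retypeBy Γ' ρ v A ⊑ A
  below {A = A} q with weakened q
  ... | C , eC , C⊑A = subst (_⊑ A) (sym (retypeBy-just Γ' ρ A eC)) C⊑A
  shared' : ∀ {w} → w ∈ fv M → lookupE Γ' (ρ w) ≈m lookupE (mapE (retypeBy Γ' ρ) Γ₁) w
  shared' {w} p rewrite lookup-mapE (retypeBy Γ' ρ) Γ₁ w with dom-lookup Γ₁ (fv⊆dom (invariant dM) p)
  ... | A , q rewrite q with weakened q
  ... | C , eC , _ rewrite eC = some ≈-refl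

renaming-inversion : ∀ {t Γ U} → t ∶ ⟨ Γ ⊢ U ⟩ → ∀ σ ρ M → IsTerm M → Renaming σ ρ M → t ≡ ssubst σ M →
                     RenSplit Γ U ρ M
renaming-inversion (ax isT) σ ρ (var w) _ R eq = ren-var isT (index R) (sym (var-injective (trans eq (agree R (here refl) tt))))
renaming-inversion ωr σ ρ M _ R refl = ren-ω σ M R
renaming-inversion (→I isT _ d) σ ρ (lam (y , K) P) (lam tP _) R refl =
  Binder.ren-abs σ ρ y K P isT d R (renaming-inversion d _ _ P tP (RenamingOn-under R) refl)
renaming-inversion (→I' isT z∉ d) σ ρ (lam (y , K) P) (lam tP _) R refl =
  Binder.ren-abs' σ ρ y K P isT z∉ d (renaming-inversion d _ _ P tP (RenamingOn-under R) refl)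
renaming-inversion (→E isT d₁ d₂ _) σ ρ (app M₁ M₂) (app t₁ t₂ _ joinable) R refl =
  ren-app isT joinable R d₁ d₂ (renaming-inversion d₁ σ ρ M₁ t₁ (RenamingOn-appˡ R) refl)
                               (renaming-inversion d₂ σ ρ M₂ t₂ (RenamingOn-appʳ R) refl)
renaming-inversion (⊓I e d₁ d₂) σ ρ M tM R eq =
  ren-⊓ e (renaming-inversion d₁ σ ρ M tM R eq) (renaming-inversion d₂ σ ρ M tM R eq)
renaming-inversion (er {R'} j d) σ ρ M tM R eq =
  ren-lift j M₀ M≡ (index R)
    (renaming-inversion d (unliftSub j σ) (unliftRen j ρ) M₀ (IsTerm-unlift j M₀ (subst IsTerm M≡ tM))
       (RenamingOn-unlift j M₀ M≡ R) R≡)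
  where
  open LiftInversion (lift-inversion j σ M R' (sym eq) (λ p → renaming-head j R p tt))
renaming-inversion (⊑r d (s , e)) σ ρ M tM R eq = ren-⊑ d s e (renaming-inversion d σ ρ M tM R eq)
-- σ(M) has the shape of M, so the remaining combinations are impossible
renaming-inversion (ax _) σ ρ (app _ _) _ _ ()
renaming-inversion (ax _) σ ρ (lam _ _) _ _ ()
renaming-inversion (→I _ _ _) σ ρ (var w) _ R eq with trans eq (agree R (here refl) tt)
... | ()
renaming-inversion (→I _ _ _) σ ρ (app _ _) _ _ ()
renaming-inversion (→I' _ _ _) σ ρ (var w) _ R eq with trans eq (agree R (here refl) tt)
... | ()
renaming-inversion (→I' _ _ _) σ ρ (app _ _) _ _ ()
renaming-inversion (→E _ _ _ _) σ ρ (var w) _ R eq with trans eq (agree R (here refl) tt)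
... | ()
renaming-inversion (→E _ _ _ _) σ ρ (lam _ _) _ _ ()

-- If σ(M) : ⟨Γ ⊢ U⟩ and x ∈ fv(M), then
-- M : ⟨Γ₁, x : V ⊢ U⟩ and N : ⟨Γ₂ ⊢ V⟩ where Γ is, up to ≈ and the renaming ρ,
-- the meet of Γ₁ and Γ₂: 'shared' describes Γ on renamed variables of M,
-- 'outside' on all other variables.

record SubstSplit (Γ : Env) (U : Ty) (ρ : Var → Var) (x : Var) (M N : Term) : Set where
  constructor substSplit
  field
    Γ₁ Γ₂ : Env
    V : Ty
    typingM : M ∶ ⟨ (x , V) ∷ Γ₁ ⊢ U ⟩
    typingN : N ∶ ⟨ Γ₂ ⊢ V ⟩
    shared : ∀ {w} → w ∈ fv M → w ≢ x → lookupE Γ (ρ w) ≈m (lookupE Γ₁ w ⊓m lookupE Γ₂ (ρ w))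
    outside : ∀ {v} → (∀ {w} → w ∈ fv M → w ≢ x → ρ w ≢ v) → lookupE Γ v ≈m lookupE Γ₂ v

SubstSplit-extend : ∀ {Γ U ρ x M N} (S : SubstSplit Γ U ρ x M N) → ∀ w → w ≢ x →
  (∀ {w'} → w' ∈ fv M → w' ≢ x → ρ w' ≡ ρ w → w' ≡ w) →
  lookupE Γ (ρ w) ≈m (lookupE (SubstSplit.Γ₁ S) w ⊓m lookupE (SubstSplit.Γ₂ S) (ρ w))
SubstSplit-extend {M = M} (substSplit Γ₁ _ _ dM _ shared outside) w w≢x only with w ∈?V fv M
... | yes p = shared p w≢x
... | no w∉ rewrite lookup-∉ Γ₁ (λ r → w∉ (dom⊆fv (invariant dM) (there r))) =
  outside (λ p' n' e → w∉ (subst (_∈ fv M) (only p' n' e) p'))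

subst-var : ∀ {Γ U ρ x N} (σ : Sub) → σ x ≡ N → deg N ≡ proj₂ x → σ x ∶ ⟨ Γ ⊢ U ⟩ → SubstSplit Γ U ρ x (var x) N
subst-var {Γ} {U} {x = x} σ refl deg-N d = substSplit [] Γ U typingM d shared (λ _ → ≈m-refl)
  where
  typingM : var x ∶ ⟨ (x , U) ∷ [] ⊢ U ⟩
  typingM = var-typing x U (wfU (invariant d)) (trans (degU (invariant d)) deg-N)
  shared : ∀ {w} → w ∈ fv (var x) → w ≢ x → _
  shared (here e) w≢x = ⊥-elim (w≢x e)

subst-ω : ∀ {ρ x N} σ M → σ x ≡ N → deg N ≡ proj₂ x → x ∈ fv M → RenamingOn (_≢ x) σ ρ M →
          SubstSplit (envω (ssubst σ M)) (ω (deg (ssubst σ M))) ρ x M N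
subst-ω {ρ} {x} {N} σ M at-x deg-N x∈M R = substSplit (rem x (envω M)) (envω N) (ω (proj₂ x)) typingM typingN shared outside
  where
  degσ : ∀ {w} → w ∈ fv M → deg (σ w) ≡ proj₂ w
  degσ {w} p with w ≟V x
  ... | yes refl = trans (cong deg at-x) deg-N
  ... | no w≢x = trans (cong deg (agree R p w≢x)) (index R w)
  gE = regular-envω M
  below : ∀ v → lookupE ((x , ω (proj₂ x)) ∷ rem x (envω M)) v ⊑m lookupE (envω M) v
  below v with v ≟V x
  ... | yes refl rewrite lookup-envω⁺ M x∈M = some (⊑-refl (ω _))
  ... | no v≢x rewrite lookup-rem x (envω M) v≢x = ⊑m-refl gE v
  typingM : M ∶ ⟨ (x , ω (proj₂ x)) ∷ rem x (envω M) ⊢ ω (deg (ssubst σ M)) ⟩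
  typingM = subst (λ L → M ∶ ⟨ (x , ω (proj₂ x)) ∷ rem x (envω M) ⊢ ω L ⟩) (sym (deg-ssubst σ M degσ))
    (weaken-env ωr gE (regular-cons (regular-rem x (envω M) gE) (rem-∉ x (envω M)) (ω _) refl) (ω _) below)
  typingN : N ∶ ⟨ envω N ⊢ ω (proj₂ x) ⟩
  typingN = subst (λ L → N ∶ ⟨ envω N ⊢ ω L ⟩) deg-N ωr
  shared : ∀ {w} → w ∈ fv M → w ≢ x →
           lookupE (envω (ssubst σ M)) (ρ w) ≈m (lookupE (rem x (envω M)) w ⊓m lookupE (envω N) (ρ w))
  shared {w} p w≢x
    rewrite lookup-envω⁺ (ssubst σ M) (fv-ssubst⁺ σ M p (subst (λ s → ρ w ∈ fv s) (sym (agree R p w≢x)) (here refl)))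
          | lookup-rem x (envω M) w≢x | lookup-envω⁺ M p with ρ w ∈?V fv N
  ... | yes q rewrite lookup-envω⁺ N q | index R w = some (≈-sym ⊓-idem)
  ... | no q rewrite lookup-envω⁻ N q | index R w = some ≈-refl
  outside : ∀ {v} → (∀ {w} → w ∈ fv M → w ≢ x → ρ w ≢ v) → lookupE (envω (ssubst σ M)) v ≈m lookupE (envω N) v
  outside {v} h with v ∈?V fv N
  ... | yes q rewrite lookup-envω⁺ N q
                    | lookup-envω⁺ (ssubst σ M) (fv-ssubst⁺ σ M x∈M (subst (λ s → v ∈ fv s) (sym at-x) q)) = some ≈-refl
  ... | no q rewrite lookup-envω⁻ N q = ≈m-≡ (lookup-envω⁻ (ssubst σ M) v∉)
    where
    v∉ : v ∉ fv (ssubst σ M)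
    v∉ r with fv-ssubst⁻ σ M r
    ... | w , p , s with w ≟V x
    ... | yes refl = q (subst (λ s' → v ∈ fv s') at-x s)
    ... | no w≢x = h p w≢x (sym (fv-var (subst (λ s' → v ∈ fv s') (agree R p w≢x) s)))

module _ {x : Var} {M : Term} {U : Ty} where

  regroup-both : ∀ {Va Vb Γa Γb} → Regular ((x , Va) ∷ Γa) → Regular ((x , Vb) ∷ Γb) →
                 M ∶ ⟨ ((x , Va) ∷ Γa) ⊓ₑ ((x , Vb) ∷ Γb) ⊢ U ⟩ → M ∶ ⟨ (x , Va ⊓ Vb) ∷ (Γa ⊓ₑ Γb) ⊢ U ⟩
  regroup-both {Va} {Vb} {Γa} {Γb} ga gb d = weaken-env d (regular (invariant d)) regular-target (wfU (invariant d)) below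
    where
    gΓ = regular-⊓ₑ Γa Γb (regular-tail ga) (regular-tail gb)
    dVa = proj₂ (regular-head ga)
    wV = _⊓_ (proj₁ (regular-head ga)) (proj₁ (regular-head gb)) (trans dVa (sym (proj₂ (regular-head gb))))
    regular-target = regular-cons gΓ (λ q → [ regular-head∉ ga , regular-head∉ gb ]′ (dom-⊓ₑ⁻ Γa Γb q)) wV dVa
    below : ∀ v → lookupE ((x , Va ⊓ Vb) ∷ (Γa ⊓ₑ Γb)) v ⊑m lookupE (((x , Va) ∷ Γa) ⊓ₑ ((x , Vb) ∷ Γb)) v
    below v rewrite lookup-⊓ₑ ((x , Va) ∷ Γa) ((x , Vb) ∷ Γb) v with v ≟V x
    ... | yes refl = some (⊑-refl wV)
    ... | no _ = subst (lookupE (Γa ⊓ₑ Γb) v ⊑m_) (lookup-⊓ₑ Γa Γb v) (⊑m-refl gΓ v)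

  regroup-left : ∀ {Va Γa Γb} → Regular ((x , Va) ∷ Γa) → Regular Γb → x ∉ dom Γb →
                 M ∶ ⟨ ((x , Va) ∷ Γa) ⊓ₑ Γb ⊢ U ⟩ → M ∶ ⟨ (x , Va) ∷ (Γa ⊓ₑ Γb) ⊢ U ⟩
  regroup-left {Va} {Γa} {Γb} ga gb x∉ d = weaken-env d (regular (invariant d)) regular-target (wfU (invariant d)) below
    where
    gΓ = regular-⊓ₑ Γa Γb (regular-tail ga) gb
    regular-target = regular-cons gΓ (λ q → [ regular-head∉ ga , x∉ ]′ (dom-⊓ₑ⁻ Γa Γb q))
                       (proj₁ (regular-head ga)) (proj₂ (regular-head ga))
    below : ∀ v → lookupE ((x , Va) ∷ (Γa ⊓ₑ Γb)) v ⊑m lookupE (((x , Va) ∷ Γa) ⊓ₑ Γb) v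
    below v rewrite lookup-⊓ₑ ((x , Va) ∷ Γa) Γb v with v ≟V x
    ... | yes refl rewrite lookup-∉ Γb x∉ = some (⊑-refl (proj₁ (regular-head ga)))
    ... | no _ = subst (lookupE (Γa ⊓ₑ Γb) v ⊑m_) (lookup-⊓ₑ Γa Γb v) (⊑m-refl gΓ v)

  regroup-right : ∀ {Vb Γa Γb} → Regular Γa → Regular ((x , Vb) ∷ Γb) → x ∉ dom Γa →
                  M ∶ ⟨ Γa ⊓ₑ ((x , Vb) ∷ Γb) ⊢ U ⟩ → M ∶ ⟨ (x , Vb) ∷ (Γa ⊓ₑ Γb) ⊢ U ⟩
  regroup-right {Vb} {Γa} {Γb} ga gb x∉ d = weaken-env d (regular (invariant d)) regular-target (wfU (invariant d)) below
    where
    gΓ = regular-⊓ₑ Γa Γb ga (regular-tail gb)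
    regular-target = regular-cons gΓ (λ q → [ x∉ , regular-head∉ gb ]′ (dom-⊓ₑ⁻ Γa Γb q))
                       (proj₁ (regular-head gb)) (proj₂ (regular-head gb))
    below : ∀ v → lookupE ((x , Vb) ∷ (Γa ⊓ₑ Γb)) v ⊑m lookupE (Γa ⊓ₑ ((x , Vb) ∷ Γb)) v
    below v rewrite lookup-⊓ₑ Γa ((x , Vb) ∷ Γb) v with v ≟V x
    ... | yes refl rewrite lookup-∉ Γa x∉ = some (⊑-refl (proj₁ (regular-head gb)))
    ... | no _ = subst (lookupE (Γa ⊓ₑ Γb) v ⊑m_) (lookup-⊓ₑ Γa Γb v) (⊑m-refl gΓ v)

app-typing : ∀ {M₁ M₂ Γa Γb U T} → IsT T → M₁ ⋄ M₂ → M₁ ∶ ⟨ Γa ⊢ U ⇒ T ⟩ → M₂ ∶ ⟨ Γb ⊢ U ⟩ →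
             app M₁ M₂ ∶ ⟨ Γa ⊓ₑ Γb ⊢ T ⟩
app-typing {M₁} {M₂} isT joinable d₁ d₂ =
  →E isT d₁ d₂ (joinable-env {M₁} {M₂} joinable (dom⊆fv (invariant d₁)) (dom⊆fv (invariant d₂)))

subst-app-both : ∀ {Γa Γb T U ρ x σ M₁ M₂ N} → IsT T → M₁ ⋄ M₂ → RenamingOn (_≢ x) σ ρ (app M₁ M₂) →
  SubstSplit Γa (U ⇒ T) ρ x M₁ N → SubstSplit Γb U ρ x M₂ N → SubstSplit (Γa ⊓ₑ Γb) T ρ x (app M₁ M₂) N
subst-app-both {Γa} {Γb} {ρ = ρ} {x} {M₁ = M₁} {M₂} isT joinable R
  Sa@(substSplit Γ₁a Γ₂a Va dMa dNa _ outside-a) Sb@(substSplit Γ₁b Γ₂b Vb dMb dNb _ outside-b) =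
  substSplit (Γ₁a ⊓ₑ Γ₁b) (Γ₂a ⊓ₑ Γ₂b) (Va ⊓ Vb) typingM typingN shared outside
  where
  gMa = regular (invariant dMa)
  gMb = regular (invariant dMb)
  gNa = regular (invariant dNa)
  gNb = regular (invariant dNb)
  dV = trans (proj₂ (regular-head gMa)) (sym (proj₂ (regular-head gMb)))
  typingM = regroup-both gMa gMb (app-typing isT joinable dMa dMb)
  typingN = meet-typings dV dNa dNb
  shared : ∀ {w} → w ∈ fv (app M₁ M₂) → w ≢ x →
           lookupE (Γa ⊓ₑ Γb) (ρ w) ≈m (lookupE (Γ₁a ⊓ₑ Γ₁b) w ⊓m lookupE (Γ₂a ⊓ₑ Γ₂b) (ρ w))
  shared {w} p w≢x rewrite lookup-⊓ₑ Γa Γb (ρ w) | lookup-⊓ₑ Γ₁a Γ₁b w | lookup-⊓ₑ Γ₂a Γ₂b (ρ w) =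
    ≈m-trans (⊓m-cong (SubstSplit-extend Sa w w≢x (λ q n e → injective R (∈-++⁺ˡ q) p n w≢x e))
                      (SubstSplit-extend Sb w w≢x (λ q n e → injective R (∈-++⁺ʳ (fv M₁) q) p n w≢x e)))
             (⊓m-interchange (lookup-deg Γ₁a w (regular-tail gMa)) (OptDeg-shift (index R w) (lookup-deg Γ₂a (ρ w) gNa))
                             (lookup-deg Γ₁b w (regular-tail gMb)) (OptDeg-shift (index R w) (lookup-deg Γ₂b (ρ w) gNb)))
  outside : ∀ {v} → (∀ {w} → w ∈ fv (app M₁ M₂) → w ≢ x → ρ w ≢ v) → lookupE (Γa ⊓ₑ Γb) v ≈m lookupE (Γ₂a ⊓ₑ Γ₂b) v
  outside {v} h rewrite lookup-⊓ₑ Γa Γb v | lookup-⊓ₑ Γ₂a Γ₂b v =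
    ⊓m-cong (outside-a (λ q → h (∈-++⁺ˡ q))) (outside-b (λ q → h (∈-++⁺ʳ (fv M₁) q)))

subst-app-left : ∀ {Γa Γb T U ρ x σ M₁ M₂ N} → IsT T → M₁ ⋄ M₂ → RenamingOn (_≢ x) σ ρ (app M₁ M₂) → x ∉ fv M₂ →
  ssubst σ M₂ ∶ ⟨ Γb ⊢ U ⟩ → SubstSplit Γa (U ⇒ T) ρ x M₁ N → RenSplit Γb U ρ M₂ →
  SubstSplit (Γa ⊓ₑ Γb) T ρ x (app M₁ M₂) N
subst-app-left {Γa} {Γb} {ρ = ρ} {x} {σ} {M₁} {M₂} isT joinable R x∉M₂ d₂
  Sa@(substSplit Γ₁a Γ₂a Va dMa dNa _ outside-a) Rb@(renSplit Γ₁b dMb _) =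
  substSplit (Γ₁a ⊓ₑ Γ₁b) Γ₂a Va typingM dNa shared outside
  where
  gMa = regular (invariant dMa)
  gMb = regular (invariant dMb)
  notX : ∀ {w} → w ∈ fv M₂ → w ≢ x
  notX q e = x∉M₂ (subst (_∈ fv M₂) e q)
  agree₂ : ∀ {w} → w ∈ fv M₂ → σ w ≡ var (ρ w)
  agree₂ q = agree R (∈-++⁺ʳ (fv M₁) q) (notX q)
  x∉Γ₁b : x ∉ dom Γ₁b
  x∉Γ₁b q = x∉M₂ (dom⊆fv (invariant dMb) q)
  typingM = regroup-left gMa gMb x∉Γ₁b (app-typing isT joinable dMa dMb)
  shared : ∀ {w} → w ∈ fv (app M₁ M₂) → w ≢ x →
           lookupE (Γa ⊓ₑ Γb) (ρ w) ≈m (lookupE (Γ₁a ⊓ₑ Γ₁b) w ⊓m lookupE Γ₂a (ρ w))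
  shared {w} p w≢x rewrite lookup-⊓ₑ Γa Γb (ρ w) | lookup-⊓ₑ Γ₁a Γ₁b w =
    ≈m-trans (⊓m-cong (SubstSplit-extend Sa w w≢x (λ q n e → injective R (∈-++⁺ˡ q) p n w≢x e))
                      (RenSplit-extend d₂ agree₂ Rb w (λ q e → injective R (∈-++⁺ʳ (fv M₁) q) p (notX q) w≢x e)))
             (⊓m-swap (lookup-deg Γ₁a w (regular-tail gMa))
                      (OptDeg-shift (index R w) (lookup-deg Γ₂a (ρ w) (regular (invariant dNa))))
                      (lookup-deg Γ₁b w gMb))
  outside : ∀ {v} → (∀ {w} → w ∈ fv (app M₁ M₂) → w ≢ x → ρ w ≢ v) → lookupE (Γa ⊓ₑ Γb) v ≈m lookupE Γ₂a v
  outside {v} h = subst (_≈m lookupE Γ₂a v)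
      (sym (trans (lookup-⊓ₑ Γa Γb v) (trans (cong (lookupE Γa v ⊓m_) (lookup-∉ Γb v∉Γb)) (⊓m-nothing (lookupE Γa v)))))
      (outside-a (λ q → h (∈-++⁺ˡ q)))
    where
    v∉Γb : v ∉ dom Γb
    v∉Γb q with renamed-dom {M₂} σ ρ d₂ agree₂ q
    ... | w , p , e = h (∈-++⁺ʳ (fv M₁) p) (notX p) e

subst-app-right : ∀ {Γa Γb T U ρ x σ M₁ M₂ N} → IsT T → M₁ ⋄ M₂ → RenamingOn (_≢ x) σ ρ (app M₁ M₂) → x ∉ fv M₁ →
  ssubst σ M₁ ∶ ⟨ Γa ⊢ U ⇒ T ⟩ → RenSplit Γa (U ⇒ T) ρ M₁ → SubstSplit Γb U ρ x M₂ N →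
  SubstSplit (Γa ⊓ₑ Γb) T ρ x (app M₁ M₂) N
subst-app-right {Γa} {Γb} {ρ = ρ} {x} {σ} {M₁} {M₂} isT joinable R x∉M₁ d₁
  Ra@(renSplit Γ₁a dMa _) Sb@(substSplit Γ₁b Γ₂b Vb dMb dNb _ outside-b) =
  substSplit (Γ₁a ⊓ₑ Γ₁b) Γ₂b Vb typingM dNb shared outside
  where
  gMa = regular (invariant dMa)
  gMb = regular (invariant dMb)
  notX : ∀ {w} → w ∈ fv M₁ → w ≢ x
  notX q e = x∉M₁ (subst (_∈ fv M₁) e q)
  agree₁ : ∀ {w} → w ∈ fv M₁ → σ w ≡ var (ρ w)
  agree₁ q = agree R (∈-++⁺ˡ q) (notX q)
  x∉Γ₁a : x ∉ dom Γ₁a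
  x∉Γ₁a q = x∉M₁ (dom⊆fv (invariant dMa) q)
  typingM = regroup-right gMa gMb x∉Γ₁a (app-typing isT joinable dMa dMb)
  shared : ∀ {w} → w ∈ fv (app M₁ M₂) → w ≢ x →
           lookupE (Γa ⊓ₑ Γb) (ρ w) ≈m (lookupE (Γ₁a ⊓ₑ Γ₁b) w ⊓m lookupE Γ₂b (ρ w))
  shared {w} p w≢x rewrite lookup-⊓ₑ Γa Γb (ρ w) | lookup-⊓ₑ Γ₁a Γ₁b w =
    ≈m-trans (⊓m-cong (RenSplit-extend d₁ agree₁ Ra w (λ q e → injective R (∈-++⁺ˡ q) p (notX q) w≢x e))
                      (SubstSplit-extend Sb w w≢x (λ q n e → injective R (∈-++⁺ʳ (fv M₁) q) p n w≢x e)))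
             (≈m-sym (⊓m-assoc (lookup-deg Γ₁a w gMa) (lookup-deg Γ₁b w (regular-tail gMb))
                               (OptDeg-shift (index R w) (lookup-deg Γ₂b (ρ w) (regular (invariant dNb))))))
  outside : ∀ {v} → (∀ {w} → w ∈ fv (app M₁ M₂) → w ≢ x → ρ w ≢ v) → lookupE (Γa ⊓ₑ Γb) v ≈m lookupE Γ₂b v
  outside {v} h = subst (_≈m lookupE Γ₂b v)
      (sym (trans (lookup-⊓ₑ Γa Γb v) (cong (_⊓m lookupE Γb v) (lookup-∉ Γa v∉Γa))))
      (outside-b (λ q → h (∈-++⁺ʳ (fv M₁) q)))
    where
    v∉Γa : v ∉ dom Γa
    v∉Γa q with renamed-dom {M₁} σ ρ d₁ agree₁ q
    ... | w , p , e = h (∈-++⁺ˡ p) (notX p) e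

subst-⊓ : ∀ {Γ U₁ U₂ ρ x M N} → degT U₁ ≡ degT U₂ → IndexPreserving ρ →
          SubstSplit Γ U₁ ρ x M N → SubstSplit Γ U₂ ρ x M N → SubstSplit Γ (U₁ ⊓ U₂) ρ x M N
subst-⊓ {Γ} {ρ = ρ} {x} {M} eU ρ-idx (substSplit Γ₁a Γ₂a Va dMa dNa shared-a outside-a)
                                 (substSplit Γ₁b Γ₂b Vb dMb dNb shared-b outside-b) =
  substSplit (Γ₁a ⊓ₑ Γ₁b) (Γ₂a ⊓ₑ Γ₂b) (Va ⊓ Vb) typingM typingN shared outside
  where
  gMa = regular (invariant dMa)
  gMb = regular (invariant dMb)
  dV = trans (proj₂ (regular-head gMa)) (sym (proj₂ (regular-head gMb)))
  typingM = regroup-both gMa gMb (meet-typings eU dMa dMb)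
  typingN = meet-typings dV dNa dNb
  shared : ∀ {w} → w ∈ fv M → w ≢ x → lookupE Γ (ρ w) ≈m (lookupE (Γ₁a ⊓ₑ Γ₁b) w ⊓m lookupE (Γ₂a ⊓ₑ Γ₂b) (ρ w))
  shared {w} p w≢x rewrite lookup-⊓ₑ Γ₁a Γ₁b w | lookup-⊓ₑ Γ₂a Γ₂b (ρ w) =
    ≈m-trans (≈m-sym ⊓m-idem) (≈m-trans (⊓m-cong (shared-a p w≢x) (shared-b p w≢x))
      (⊓m-interchange (lookup-deg Γ₁a w (regular-tail gMa))
                      (OptDeg-shift (ρ-idx w) (lookup-deg Γ₂a (ρ w) (regular (invariant dNa))))
                      (lookup-deg Γ₁b w (regular-tail gMb))
                      (OptDeg-shift (ρ-idx w) (lookup-deg Γ₂b (ρ w) (regular (invariant dNb))))))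
  outside : ∀ {v} → (∀ {w} → w ∈ fv M → w ≢ x → ρ w ≢ v) → lookupE Γ v ≈m lookupE (Γ₂a ⊓ₑ Γ₂b) v
  outside {v} h rewrite lookup-⊓ₑ Γ₂a Γ₂b v = ≈m-trans (≈m-sym ⊓m-idem) (⊓m-cong (outside-a h) (outside-b h))

module SubstBinder (σ : Sub) (ρ : Var → Var) (y : ℕ) (K : Index) (P : Term) where
  open Binder σ ρ y K P

  subst-abs : ∀ {Γ U T x N} → IsT T → (z , K) ∉ dom Γ → ssubst σ' P ∶ ⟨ ((z , K) , U) ∷ Γ ⊢ T ⟩ →
    x ∈ fv (lam (y , K) P) → σ x ≡ N → RenamingOn (_≢ x) σ ρ (lam (y , K) P) →
    SubstSplit (((z , K) , U) ∷ Γ) T ρ' x P N → SubstSplit Γ (U ⇒ T) ρ x (lam (y , K) P) N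
  subst-abs {Γ} {U} {T} {x} {N} isT z∉Γ d x∈ at-x R (substSplit Γ₁ Γ₂ V dP dN shared' outside') =
    substSplit (rem (y , K) Γ₁) Γ₂ V typingM dN shared outside
    where
    y≢x : (y , K) ≢ x
    y≢x e = proj₂ (fv-lam⁻ P x∈) (sym e)
    z∉N : lookupE Γ₂ (z , K) ≡ nothing
    z∉N = lookup-∉ Γ₂ (λ q → binderName-fresh σ y K P K x∈ (subst (λ s → (z , K) ∈ fv s) (sym at-x)
                               (dom⊆fv (invariant dN) q)) refl)
    U-declared : Σ Ty λ U' → lookupE Γ₁ (y , K) ≡ just U' × U ≈ U'
    U-declared = OptRel-just (subst₂ _≈m_ (lookup-binder Γ U)
      (trans (cong (λ a → lookupE Γ₁ (y , K) ⊓m lookupE Γ₂ a) (extendRen-here ρ y K z))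
             (trans (cong (lookupE Γ₁ (y , K) ⊓m_) z∉N) (⊓m-nothing _)))
      (shared' (binder-used d) y≢x))
    typingM : lam (y , K) P ∶ ⟨ (x , V) ∷ rem (y , K) Γ₁ ⊢ U ⇒ T ⟩
    typingM = subst (λ Θ → lam (y , K) P ∶ ⟨ Θ ⊢ U ⇒ T ⟩) (rem-cons V Γ₁ (λ e → y≢x (sym e)))
      (abstraction-typing isT (proj₁ (regular-head (regular (invariant d)))) dP
         (trans (lookup-there V Γ₁ y≢x) (proj₁ (proj₂ U-declared))) (proj₂ (proj₂ U-declared)))
    shared : ∀ {w} → w ∈ fv (lam (y , K) P) → w ≢ x →
             lookupE Γ (ρ w) ≈m (lookupE (rem (y , K) Γ₁) w ⊓m lookupE Γ₂ (ρ w))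
    shared {w} p w≢x = subst₂ _≈m_ (lookup-other Γ U p (agree R p w≢x))
      (cong₂ _⊓m_ (sym (lookup-rem (y , K) Γ₁ w≢y)) (cong (lookupE Γ₂) (extendRen-there ρ y K z w≢y)))
      (shared' (proj₁ (fv-lam⁻ P p)) w≢x)
      where w≢y = proj₂ (fv-lam⁻ P p)
    outside : ∀ {v} → (∀ {w} → w ∈ fv (lam (y , K) P) → w ≢ x → ρ w ≢ v) → lookupE Γ v ≈m lookupE Γ₂ v
    outside {v} h with v ≟V (z , K)
    ... | yes refl rewrite lookup-∉ Γ z∉Γ | z∉N = none
    ... | no v≢z = subst (_≈m lookupE Γ₂ v) (lookup-there U Γ v≢z) (outside' h')
      where
      h' : ∀ {w} → w ∈ fv P → w ≢ x → ρ' w ≢ v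
      h' {w} p w≢x with w ≟V (y , K)
      ... | yes refl = λ e → v≢z (sym e)
      ... | no w≢y = h (fv-lam⁺ P p w≢y) w≢x

  subst-abs' : ∀ {Γ T x N} → IsT T → (z , K) ∉ dom Γ → ssubst σ' P ∶ ⟨ Γ ⊢ T ⟩ → x ∈ fv (lam (y , K) P) →
    SubstSplit Γ T ρ' x P N → SubstSplit Γ (ω K ⇒ T) ρ x (lam (y , K) P) N
  subst-abs' {Γ} {T} {x} isT z∉Γ d x∈ (substSplit Γ₁ Γ₂ V dP dN shared' outside') =
    substSplit Γ₁ Γ₂ V typingM dN shared outside
    where
    y∉P : (y , K) ∉ fv P
    y∉P = binder-unused z∉Γ d
    y∉ : (y , K) ∉ dom ((x , V) ∷ Γ₁)
    y∉ (here e) = proj₂ (fv-lam⁻ P x∈) (sym e)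
    y∉ (there q) = y∉P (dom⊆fv (invariant dP) (there q))
    typingM : lam (y , K) P ∶ ⟨ (x , V) ∷ Γ₁ ⊢ ω K ⇒ T ⟩
    typingM = →I' isT y∉ dP
    shared : ∀ {w} → w ∈ fv (lam (y , K) P) → w ≢ x → lookupE Γ (ρ w) ≈m (lookupE Γ₁ w ⊓m lookupE Γ₂ (ρ w))
    shared {w} p w≢x = subst (λ a → lookupE Γ a ≈m (lookupE Γ₁ w ⊓m lookupE Γ₂ a))
                         (extendRen-there ρ y K z (proj₂ (fv-lam⁻ P p))) (shared' (proj₁ (fv-lam⁻ P p)) w≢x)
    outside : ∀ {v} → (∀ {w} → w ∈ fv (lam (y , K) P) → w ≢ x → ρ w ≢ v) → lookupE Γ v ≈m lookupE Γ₂ v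
    outside {v} h = outside' h'
      where
      h' : ∀ {w} → w ∈ fv P → w ≢ x → ρ' w ≢ v
      h' {w} p w≢x with w ≟V (y , K)
      ... | yes refl = ⊥-elim (y∉P p)
      ... | no w≢y = h (fv-lam⁺ P p w≢y) w≢x

record SubstUnlifting (j : ℕ) (σ : Sub) (ρ : Var → Var) (x : Var) (M N R : Term) : Set where
  field
    M₀ N₀ : Term
    x₀ : Var
    M≡ : M ≡ lift j M₀
    N≡ : N ≡ lift j N₀
    x≡ : x ≡ liftV j x₀
    R≡ : R ≡ ssubst (unliftSub j σ) M₀
    x₀∈M₀ : x₀ ∈ fv M₀
    at-x₀ : unliftSub j σ x₀ ≡ N₀
    deg-N₀ : deg N₀ ≡ proj₂ x₀
    renaming₀ : RenamingOn (_≢ x₀) (unliftSub j σ) (unliftRen j ρ) M₀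

subst-unlifting : ∀ j σ ρ x M N R → σ x ≡ N → deg N ≡ proj₂ x → x ∈ fv M → RenamingOn (_≢ x) σ ρ M →
                  ssubst σ M ≡ lift j R → SubstUnlifting j σ ρ x M N R
subst-unlifting j σ ρ x M N R at-x deg-N x∈M Rn e = record
  { M₀ = M₀ ; N₀ = unlift N ; x₀ = x₀ ; M≡ = M≡ ; N≡ = sym (lift-unlift N-lifted) ; x≡ = x≡ ; R≡ = R≡
  ; x₀∈M₀ = x₀∈M₀
  ; at-x₀ = cong unlift (trans (cong σ (sym x≡)) at-x)
  ; deg-N₀ = ListP.∷-injectiveʳ (trans (sym (trans (cong deg (sym (lift-unlift N-lifted))) (deg-lift j (unlift N))))
                                       (trans deg-N (cong proj₂ x≡)))
  ; renaming₀ = RenamingOn-mono (λ _ w≢x₀ e' → w≢x₀ (liftV-injective (trans e' x≡))) (RenamingOn-unlift j M₀ M≡ Rn) }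
  where
  head : ∀ {w} → w ∈ fv M → Lifted j (σ w) → HeadIndex j w
  head {w} p l with w ≟V x
  ... | yes refl with Lifted-deg (subst (Lifted j) at-x l)
  ... | K , e' = K , trans (sym deg-N) e'
  head {w} p l | no w≢x = renaming-head j Rn p w≢x l
  open LiftInversion (lift-inversion j σ M R e head)
  N-lifted : Lifted j N
  N-lifted = subst (Lifted j) at-x (Lifted-ssubst-sub σ M (subst (Lifted j) (sym e) (lift-Lifted j R)) x∈M)
  x₀-data = fv-lift⁻ j M₀ (subst (λ m → x ∈ fv m) M≡ x∈M)
  x₀ = proj₁ x₀-data
  x₀∈M₀ = proj₁ (proj₂ x₀-data)
  x≡ = proj₂ (proj₂ x₀-data)

head-index : ∀ {j i n K v₀} → (n , i ∷ K) ≡ liftV j v₀ → i ≡ j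
head-index e = proj₁ (ListP.∷-injective (cong proj₂ e))

subst-lift : ∀ {Γ₀ U₀ ρ x₀ M₀ N₀} j → IndexPreserving ρ → SubstSplit Γ₀ U₀ (unliftRen j ρ) x₀ M₀ N₀ →
             SubstSplit (ēₑ j Γ₀) (ē j U₀) ρ (liftV j x₀) (lift j M₀) (lift j N₀)
subst-lift {Γ₀} {ρ = ρ} {x₀} {M₀} j ρ-idx (substSplit Γ₁ Γ₂ V dM dN shared₀ outside₀) =
  substSplit (ēₑ j Γ₁) (ēₑ j Γ₂) (ē j V) (er j dM) (er j dN) shared outside
  where
  ρ₀ = unliftRen j ρ
  shared : ∀ {w} → w ∈ fv (lift j M₀) → w ≢ liftV j x₀ →
           lookupE (ēₑ j Γ₀) (ρ w) ≈m (lookupE (ēₑ j Γ₁) w ⊓m lookupE (ēₑ j Γ₂) (ρ w))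
  shared p w≢x with fv-lift⁻ j M₀ p
  ... | w₀ , q , refl rewrite renaming-lift j ρ ρ-idx w₀ | lookup-ēₑ j Γ₀ (ρ₀ w₀) | lookup-ēₑ j Γ₁ w₀ | lookup-ēₑ j Γ₂ (ρ₀ w₀) =
    ≈m-trans (≈m-mapē (shared₀ q (λ e → w≢x (cong (liftV j) e))))
             (mapē-⊓m (lookup-deg Γ₁ w₀ (regular-tail (regular (invariant dM))))
                      (OptDeg-shift (cong dropHead (ρ-idx (liftV j w₀))) (lookup-deg Γ₂ (ρ₀ w₀) (regular (invariant dN)))))
  outside : ∀ {v} → (∀ {w} → w ∈ fv (lift j M₀) → w ≢ liftV j x₀ → ρ w ≢ v) → lookupE (ēₑ j Γ₀) v ≈m lookupE (ēₑ j Γ₂) v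
  outside {n , []} h rewrite lookup-ēₑ-other j Γ₀ (n , []) (λ v₀ ()) | lookup-ēₑ-other j Γ₂ (n , []) (λ v₀ ()) = none
  outside {n , (i ∷ K)} h with i ℕP.≟ j
  ... | yes refl rewrite lookup-ēₑ j Γ₀ (n , K) | lookup-ēₑ j Γ₂ (n , K) = ≈m-mapē (outside₀ h₀)
    where
    h₀ : ∀ {w₀} → w₀ ∈ fv M₀ → w₀ ≢ x₀ → ρ₀ w₀ ≢ (n , K)
    h₀ {w₀} q w₀≢x₀ e = h (fv-lift⁺ j M₀ q) (λ e' → w₀≢x₀ (liftV-injective e')) (trans (renaming-lift j ρ ρ-idx w₀) (cong (liftV j) e))
  ... | no i≢j rewrite lookup-ēₑ-other j Γ₀ (n , i ∷ K) (λ v₀ e → i≢j (head-index e))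
                      | lookup-ēₑ-other j Γ₂ (n , i ∷ K) (λ v₀ e → i≢j (head-index e)) = none

preimage : (ρ : Var → Var) (x : Var) (xs : List Var) (v : Var) →
           (Σ Var λ w → w ∈ xs × w ≢ x × ρ w ≡ v) ⊎ (∀ {w} → w ∈ xs → w ≢ x → ρ w ≢ v)
preimage ρ x [] v = inj₂ (λ ())
preimage ρ x (w ∷ xs) v with w ≟V x | ρ w ≟V v | preimage ρ x xs v
... | no w≢x | yes e | _ = inj₁ (w , here refl , w≢x , e)
... | _ | _ | inj₁ (w' , p , w'≢x , e) = inj₁ (w' , there p , w'≢x , e)
... | yes refl | _ | inj₂ h = inj₂ (λ { (here refl) w≢x _ → w≢x refl ; (there p) → h p })
... | no _ | no ρw≢v | inj₂ h = inj₂ (λ { (here refl) _ e → ρw≢v e ; (there p) → h p })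

meet-presentˡ : ∀ {a A m} → a ≈m (just A ⊓m m) → Σ Ty λ D → a ≡ just D × just D ≈m (just A ⊓m m)
meet-presentˡ {m = nothing} (some p) = _ , refl , some p
meet-presentˡ {m = just _} (some p) = _ , refl , some p

meet-presentʳ : ∀ {a B m} → a ≈m (m ⊓m just B) → Σ Ty λ D → a ≡ just D × just D ≈m (m ⊓m just B)
meet-presentʳ {m = nothing} (some p) = _ , refl , some p
meet-presentʳ {m = just _} (some p) = _ , refl , some p

module _ {t Γ Γ' U ρ x M N} (d : t ∶ ⟨ Γ ⊢ U ⟩) (e : Γ' ⊑ₑ Γ) (ρ-idx : IndexPreserving ρ)
         (S : SubstSplit Γ U ρ x M N) where
  open SubstSplit S
  private
    gΓ = regular (invariant d)
    gM = regular (invariant typingM)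
    gΓ₁ = regular-tail gM
    gΓ₂ = regular (invariant typingN)

  weakened₁ : ∀ {v A} → lookupE Γ₁ v ≡ just A → Σ Ty λ C → lookupE Γ' (ρ v) ≡ just C × C ⊑ A
  weakened₁ {v} {A} q with meet-presentˡ {m = lookupE Γ₂ (ρ v)} (subst (λ m → lookupE Γ (ρ v) ≈m (m ⊓m lookupE Γ₂ (ρ v))) q (shared v∈M v≢x))
    where
    v∈M : v ∈ fv M
    v∈M = dom⊆fv (invariant typingM) (there (lookup-dom Γ₁ q))
    v≢x : v ≢ x
    v≢x e' = regular-head∉ gM (subst (_∈ dom Γ₁) e' (lookup-dom Γ₁ q))
  ... | D , eD , D≈ = ⊑ₑ-below (ρ v) e gΓ eD (⊓m-elimˡ (proj₁ (lookup-regular Γ gΓ eD)) (proj₁ (lookup-regular Γ₁ gΓ₁ q)) degB D≈)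
    where
    degB : ∀ {B} → lookupE Γ₂ (ρ v) ≡ just B → WfU B × degT B ≡ degT A
    degB r = proj₁ (lookup-regular Γ₂ gΓ₂ r) ,
             trans (proj₂ (lookup-regular Γ₂ gΓ₂ r)) (trans (ρ-idx v) (sym (proj₂ (lookup-regular Γ₁ gΓ₁ q))))

  weakened₂ : ∀ {v B} → lookupE Γ₂ v ≡ just B → Σ Ty λ C → lookupE Γ' v ≡ just C × C ⊑ B
  weakened₂ {v} {B} q with preimage ρ x (fv M) v
  ... | inj₁ (w , p , w≢x , refl) with meet-presentʳ {m = lookupE Γ₁ w} (subst (λ m → lookupE Γ (ρ w) ≈m (lookupE Γ₁ w ⊓m m)) q (shared p w≢x))
  ... | D , eD , D≈ = ⊑ₑ-below (ρ w) e gΓ eD (⊓m-elimʳ (proj₁ (lookup-regular Γ gΓ eD)) (proj₁ (lookup-regular Γ₂ gΓ₂ q)) degA D≈)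
    where
    degA : ∀ {A} → lookupE Γ₁ w ≡ just A → WfU A × degT A ≡ degT B
    degA r = proj₁ (lookup-regular Γ₁ gΓ₁ r) ,
             trans (proj₂ (lookup-regular Γ₁ gΓ₁ r)) (trans (sym (ρ-idx w)) (sym (proj₂ (lookup-regular Γ₂ gΓ₂ q))))
  weakened₂ {v} {B} q | inj₂ h with OptRel-just⁻ (subst (lookupE Γ v ≈m_) q (outside h))
  ... | D , eD , D≈B = ⊑ₑ-below v e gΓ eD (⊑-≈ (proj₁ (lookup-regular Γ gΓ eD)) (proj₁ (lookup-regular Γ₂ gΓ₂ q)) D≈B)

  outside-undeclared : ∀ {v} → (∀ {w} → w ∈ fv M → w ≢ x → ρ w ≢ v) → lookupE Γ₂ v ≡ nothing → lookupE Γ' v ≡ nothing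
  outside-undeclared {v} h q = OptRel-nothing (subst (lookupE Γ' v ⊑m_) (OptRel-nothing (subst (lookupE Γ v ≈m_) q (outside h)))
                                                     (⊑ₑ-lookup e gΓ v))

retypeExcept : Var → Env → (Var → Var) → Var → Ty → Ty
retypeExcept x Γ' ρ w A = if does (w ≟V x) then A else retypeBy Γ' ρ w A

subst-⊑ : ∀ {t Γ Γ' U U' ρ x M N} → t ∶ ⟨ Γ ⊢ U ⟩ → U ⊑ U' → Γ' ⊑ₑ Γ → IndexPreserving ρ →
          SubstSplit Γ U ρ x M N → SubstSplit Γ' U' ρ x M N
subst-⊑ {Γ' = Γ'} {U' = U'} {ρ} {x} {M} d s e ρ-idx S@(substSplit Γ₁ Γ₂ V dM dN _ _) =
  substSplit (mapE g₁ Γ₁) (mapE g₂ Γ₂) V typingM typingN shared outside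
  where
  g₁ = retypeExcept x Γ' ρ
  g₂ = retypeBy Γ' (λ v → v)
  gM = regular (invariant dM)
  below₁ : ∀ {v A} → lookupE ((x , V) ∷ Γ₁) v ≡ just A → g₁ v A ⊑ A
  below₁ {v} {A} q with v ≟V x | q
  ... | yes refl | refl = ⊑-refl (proj₁ (regular-head gM))
  ... | no _ | q' with weakened₁ d e ρ-idx S q'
  ... | C , eC , C⊑A = subst (_⊑ A) (sym (retypeBy-just Γ' ρ A eC)) C⊑A
  below₂ : ∀ {v B} → lookupE Γ₂ v ≡ just B → g₂ v B ⊑ B
  below₂ {B = B} q with weakened₂ d e ρ-idx S q
  ... | C , eC , C⊑B = subst (_⊑ B) (sym (retypeBy-just Γ' (λ v → v) B eC)) C⊑B
  g₁-x : g₁ x V ≡ V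
  g₁-x rewrite dec-true (x ≟V x) refl = refl
  typingM : M ∶ ⟨ (x , V) ∷ mapE g₁ Γ₁ ⊢ U' ⟩
  typingM = subst (λ A → M ∶ ⟨ (x , A) ∷ mapE g₁ Γ₁ ⊢ U' ⟩) g₁-x (retype-typing g₁ dM s below₁)
  typingN = retype-typing g₂ dN (⊑-refl (proj₁ (regular-head gM))) below₂
  shared : ∀ {w} → w ∈ fv M → w ≢ x → lookupE Γ' (ρ w) ≈m (lookupE (mapE g₁ Γ₁) w ⊓m lookupE (mapE g₂ Γ₂) (ρ w))
  shared {w} p w≢x rewrite lookup-mapE g₁ Γ₁ w | lookup-mapE g₂ Γ₂ (ρ w) | dec-false (w ≟V x) w≢x
    with dom-lookup Γ₁ (there⁻ (fv⊆dom (invariant dM) p))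
    where
    there⁻ : w ∈ dom ((x , V) ∷ Γ₁) → w ∈ dom Γ₁
    there⁻ (here e') = ⊥-elim (w≢x e')
    there⁻ (there r) = r
  ... | A , q rewrite q with weakened₁ d e ρ-idx S q
  ... | C , eC , _ rewrite eC with lookupE Γ₂ (ρ w)
  ... | just B = some (≈-sym ⊓-idem)
  ... | nothing = some ≈-refl
  outside : ∀ {v} → (∀ {w} → w ∈ fv M → w ≢ x → ρ w ≢ v) → lookupE Γ' v ≈m lookupE (mapE g₂ Γ₂) v
  outside {v} h rewrite lookup-mapE g₂ Γ₂ v with lookupE Γ₂ v in q
  ... | just B with weakened₂ d e ρ-idx S q
  ... | C , eC , _ rewrite eC = some ≈-refl
  outside {v} h | nothing = ≈m-≡ (outside-undeclared d e ρ-idx S h q)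

SubstSplit-transport : ∀ {Γ U ρ x x' M M' N N'} → x ≡ x' → M ≡ M' → N ≡ N' →
                       SubstSplit Γ U ρ x' M' N' → SubstSplit Γ U ρ x M N
SubstSplit-transport refl refl refl S = S

substitution-inversion : ∀ {t Γ U} → t ∶ ⟨ Γ ⊢ U ⟩ → ∀ σ ρ x M N → IsTerm M → σ x ≡ N → deg N ≡ proj₂ x →
  x ∈ fv M → RenamingOn (_≢ x) σ ρ M → t ≡ ssubst σ M → SubstSplit Γ U ρ x M N
substitution-inversion d σ ρ x (var x) N _ at-x deg-N (here refl) R eq = subst-var σ at-x deg-N (subst (_∶ _) eq d)
substitution-inversion ωr σ ρ x M N _ at-x deg-N x∈ R refl = subst-ω σ M at-x deg-N x∈ R
substitution-inversion (→I isT z∉ d) σ ρ x (lam (y , K) P) N (lam tP _) at-x deg-N x∈ R refl =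
  SubstBinder.subst-abs σ ρ y K P isT z∉ d x∈ at-x R
    (substitution-inversion d _ _ x P N tP (trans (extendSub-there σ y K _ (proj₂ (fv-lam⁻ P x∈))) at-x) deg-N
       (proj₁ (fv-lam⁻ P x∈)) (RenamingOn-under R) refl)
substitution-inversion (→I' isT z∉ d) σ ρ x (lam (y , K) P) N (lam tP _) at-x deg-N x∈ R refl =
  SubstBinder.subst-abs' σ ρ y K P isT z∉ d x∈
    (substitution-inversion d _ _ x P N tP (trans (extendSub-there σ y K _ (proj₂ (fv-lam⁻ P x∈))) at-x) deg-N
       (proj₁ (fv-lam⁻ P x∈)) (RenamingOn-under R) refl)
substitution-inversion (→E isT d₁ d₂ _) σ ρ x (app M₁ M₂) N (app t₁ t₂ _ joinable) at-x deg-N x∈ R refl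
  with x ∈?V fv M₁ | x ∈?V fv M₂
... | yes x∈M₁ | yes x∈M₂ =
  subst-app-both isT joinable R (substitution-inversion d₁ σ ρ x M₁ N t₁ at-x deg-N x∈M₁ (RenamingOn-appˡ R) refl)
                                (substitution-inversion d₂ σ ρ x M₂ N t₂ at-x deg-N x∈M₂ (RenamingOn-appʳ R) refl)
... | yes x∈M₁ | no x∉M₂ =
  subst-app-left isT joinable R x∉M₂ d₂ (substitution-inversion d₁ σ ρ x M₁ N t₁ at-x deg-N x∈M₁ (RenamingOn-appˡ R) refl)
    (renaming-inversion d₂ σ ρ M₂ t₂ (RenamingOn-mono (λ q _ e → x∉M₂ (subst (_∈ fv M₂) e q)) (RenamingOn-appʳ R)) refl)
... | no x∉M₁ | yes x∈M₂ =
  subst-app-right isT joinable R x∉M₁ d₁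
    (renaming-inversion d₁ σ ρ M₁ t₁ (RenamingOn-mono (λ q _ e → x∉M₁ (subst (_∈ fv M₁) e q)) (RenamingOn-appˡ R)) refl)
    (substitution-inversion d₂ σ ρ x M₂ N t₂ at-x deg-N x∈M₂ (RenamingOn-appʳ R) refl)
... | no x∉M₁ | no x∉M₂ = ⊥-elim ([ x∉M₁ , x∉M₂ ]′ (∈-++⁻ (fv M₁) x∈))
substitution-inversion (⊓I e d₁ d₂) σ ρ x M N tM at-x deg-N x∈ R eq =
  subst-⊓ e (index R) (substitution-inversion d₁ σ ρ x M N tM at-x deg-N x∈ R eq)
                      (substitution-inversion d₂ σ ρ x M N tM at-x deg-N x∈ R eq)
substitution-inversion (er {R'} j d) σ ρ x M N tM at-x deg-N x∈ R eq =
  SubstSplit-transport x≡ M≡ N≡ (subst-lift j (index R)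
    (substitution-inversion d (unliftSub j σ) (unliftRen j ρ) x₀ M₀ N₀ (IsTerm-unlift j M₀ (subst IsTerm M≡ tM))
       at-x₀ deg-N₀ x₀∈M₀ renaming₀ R≡))
  where open SubstUnlifting (subst-unlifting j σ ρ x M N R' at-x deg-N x∈ R (sym eq))
substitution-inversion (⊑r d (s , e)) σ ρ x M N tM at-x deg-N x∈ R eq =
  subst-⊑ d s e (index R) (substitution-inversion d σ ρ x M N tM at-x deg-N x∈ R eq)
-- σ(M) has the shape of M, so the remaining combinations are impossible
substitution-inversion (ax _) σ ρ x (app _ _) N _ _ _ _ _ ()
substitution-inversion (ax _) σ ρ x (lam _ _) N _ _ _ _ _ ()
substitution-inversion (→I _ _ _) σ ρ x (app _ _) N _ _ _ _ _ ()
substitution-inversion (→I' _ _ _) σ ρ x (app _ _) N _ _ _ _ _ ()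
substitution-inversion (→E _ _ _ _) σ ρ x (lam _ _) N _ _ _ _ _ ()

regular⇒wf : ∀ {Γ} → Regular Γ → WfEnv Γ
regular⇒wf (u , a) = u , All.map proj₁ a

substitution-renaming : ∀ M N v → RenamingOn (_≢ v) (λ w → if does (w ≟V v) then N else var w) (λ w → w) M
substitution-renaming M N v = record
  { agree = λ {w} _ w≢v → subst (λ b → (if b then N else var w) ≡ var w) (sym (dec-false (w ≟V v) w≢v)) refl
  ; index = λ _ → refl
  ; injective = λ _ _ _ _ e → e }

lemma7 : ∀ (M N : Term) (x : ℕ) (L : Index) (Γ : Env) (U : Ty) →
    IsTerm M → IsTerm N → M ⋄ N → deg N ≡ L →
    M [ (x , L) ≔ N ] ∶ ⟨ Γ ⊢ U ⟩ → (x , L) ∈ fv M →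
    Σ Ty λ V → Σ Env λ Γ₁ → Σ Env λ Γ₂ →
      WfU V × WfEnv Γ₁ × WfEnv Γ₂ × (x , L) ∉ dom Γ₁ ×
      (M ∶ ⟨ Γ₁ ,, ((x , L) , V) ⊢ U ⟩) × (N ∶ ⟨ Γ₂ ⊢ V ⟩) × Γ ≋ (Γ₁ ⊓ₑ Γ₂)
lemma7 M N x L Γ U tM _ _ deg-N d x∈M =
  V , Γ₁ , Γ₂ , proj₁ (regular-head gM) , regular⇒wf gΓ₁ , regular⇒wf gΓ₂ , regular-head∉ gM ,
  typingM , typingN , pointwise⇒≋ (regular (invariant d)) (regular-⊓ₑ Γ₁ Γ₂ gΓ₁ gΓ₂) meets
  where
  σ = λ w → if does (w ≟V (x , L)) then N else var w
  at-x : σ (x , L) ≡ N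
  at-x rewrite dec-true ((x , L) ≟V (x , L)) refl = refl
  open SubstSplit (substitution-inversion d σ (λ w → w) (x , L) M N tM at-x deg-N x∈M (substitution-renaming M N (x , L)) refl)
  gM = regular (invariant typingM)
  gΓ₁ = regular-tail gM
  gΓ₂ = regular (invariant typingN)
  undeclared : ∀ {v} → (∀ {w} → w ∈ fv M → w ≢ (x , L) → w ≢ v) → v ∉ dom Γ₁
  undeclared h q = h (dom⊆fv (invariant typingM) (there q)) (λ e → regular-head∉ gM (subst (_∈ dom Γ₁) e q)) refl
  meets : ∀ v → lookupE Γ v ≈m lookupE (Γ₁ ⊓ₑ Γ₂) v
  meets v rewrite lookup-⊓ₑ Γ₁ Γ₂ v with preimage (λ w → w) (x , L) (fv M) v
  ... | inj₁ (w , p , w≢x , refl) = shared p w≢x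
  ... | inj₂ h = subst (λ m → lookupE Γ v ≈m (m ⊓m lookupE Γ₂ v)) (sym (lookup-∉ Γ₁ (undeclared h))) (outside h)
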